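{- For all integers $r,n\ge0$, let $C_n(r;s,q,Y)$ be the coefficient of $u^n$ in the expansion as a power series in $u$ of $$C(r;u,s,q,Y)=\frac{(1-qs)\,(u;q)_r\,(usq;q)_r}{\bigl((u;q)_r-sq\,(usq;q)_r\bigr)\,(uY;q)_{r+1}}.$$ Then $$C_n(r;s,q,Y)=\sum_{w\in W_n(r)}s^{\mathrm{dec}\,w}\,q^{\mathrm{tot}\,w}\,Y^{\mathrm{single}\,w}.$$
   Context: $(a;q)_0=1$, $(a;q)_n=(1-a)\cdots(1-aq^{n-1})$. $W_n(r)=\{0,\dots,r\}^n$; $\mathrm{tot}\,w$ is the sum of the letters of $w$. For $w=x_1\cdots x_n$, $i\in\{1,\dots,n-1\}$ is a decrease if $x_i\ge x_{i+1}\ge\cdots\ge x_j>x_{j+1}$ for some $i\le j\le n-1$; $\mathrm{dec}\,w$ is their number. A nonempty word is Lyndon if it has length $1$ or is lexicographically strictly greater than all its proper cyclic rotations; for primitive words $w\preceq w'$ iff $w^b\le w'^b$ lexicographically for large $b$; every nonempty word factors uniquely as $l_1\cdots l_k$ with Lyndon $l_1\preceq\cdots\preceq l_k$, and $\mathrm{single}\,w$ is the number of one-letter factors ($0$ for the empty word). -}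

module Defs where

open import Level using (Level)
open import Algebra.Bundles using (CommutativeRing)
open import Data.Nat using (ℕ; zero; suc; _∸_; _<_; _≤_; _≥_)
open import Data.List using (List; []; _∷_; _++_; map; concat; concatMap; length; drop; take; upTo; filter)
open import Data.Nat.ListAction using (sum)
open import Data.List.Relation.Unary.All using (All)
open import Data.List.Relation.Unary.Linked using (Linked)
open import Data.Product using (_×_; ∃)
open import Data.Bool using (Bool; true; false; if_then_else_)
open import Data.Nat using (_<ᵇ_; _≡ᵇ_)
open import Relation.Binary.PropositionalEquality using (_≡_; _≢_)
import Data.Nat as ℕ

Word : Set
Word = List ℕ

-- W_n(r) = {0,…,r}^n, enumerated explicitly (each word exactly once).
words : ℕ → ℕ → List Word
words r zero    = [] ∷ []
words r (suc n) = concatMap (λ x → map (x ∷_) (words r n)) (upTo (suc r))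

tot : Word → ℕ
tot = sum

-- isDecAt (x_i x_{i+1} … x_n): does there exist j ≥ i with
-- x_i ≥ x_{i+1} ≥ … ≥ x_j > x_{j+1} ?
isDecAt : Word → Bool
isDecAt []            = false
isDecAt (x ∷ [])      = false
isDecAt (x ∷ y ∷ ys)  =
  if y <ᵇ x then true else (if x ≡ᵇ y then isDecAt (y ∷ ys) else false)

-- dec w : number of positions i (1 ≤ i ≤ n-1) that are decreases;
-- position i corresponds to the suffix starting at x_i (the last
-- suffix, of length 1, never counts).
dec : Word → ℕ
dec []       = 0
dec (x ∷ xs) = (if isDecAt (x ∷ xs) then 1 else 0) ℕ.+ dec xs

data _≤L_ : Word → Word → Set where
  []≤ : ∀ {ys} → [] ≤L ys
  <≤  : ∀ {x y xs ys} → x < y → (x ∷ xs) ≤L (y ∷ ys)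
  ≡≤  : ∀ {x xs ys} → xs ≤L ys → (x ∷ xs) ≤L (x ∷ ys)

_<L_ : Word → Word → Set
w <L w' = (w ≤L w') × (w ≢ w')

rot : ℕ → Word → Word
rot k w = drop k w ++ take k w

Lyndon : Word → Set
Lyndon w = (0 < length w) × (∀ k → 0 < k → k < length w → rot k w <L w)

pow : ℕ → Word → Word
pow zero    w = []
pow (suc b) w = w ++ pow b w

_⪯_ : Word → Word → Set
w ⪯ w' = ∃ λ B → ∀ b → b ≥ B → pow b w ≤L pow b w'

IsLyndonFactorization : Word → List Word → Set
IsLyndonFactorization w ls = (concat ls ≡ w) × All Lyndon ls × Linked _⪯_ ls

singles : List Word → ℕ
singles []       = 0
singles (l ∷ ls) = (if length l ≡ᵇ 1 then 1 else 0) ℕ.+ singles ls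

module Series {c ℓ : Level} (R : CommutativeRing c ℓ) where
  open CommutativeRing R

  PS : Set c
  PS = ℕ → Carrier

  _^R_ : Carrier → ℕ → Carrier
  a ^R zero  = 1#
  a ^R suc k = a * (a ^R k)

  sumTo : ℕ → (ℕ → Carrier) → Carrier
  sumTo zero    h = 0#
  sumTo (suc m) h = sumTo m h + h m

  _⊛_ : PS → PS → PS
  (f ⊛ g) n = sumTo (suc n) (λ k → f k * g (n ∸ k))

  _⊝_ : PS → PS → PS
  (f ⊝ g) n = f n - g n

  _·_ : Carrier → PS → PS
  (a · f) n = a * f n

  oneS : PS
  oneS zero    = 1#
  oneS (suc n) = 0#

  lin : Carrier → PS
  lin a zero          = 1#
  lin a (suc zero)    = - a
  lin a (suc (suc n)) = 0#

  -- (a u; q)_m = (1 - a u)(1 - a q u)⋯(1 - a q^{m-1} u)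
  poch : Carrier → Carrier → ℕ → PS
  poch a q zero    = oneS
  poch a q (suc m) = poch a q m ⊛ lin (a * (q ^R m))

  numer : ℕ → Carrier → Carrier → PS
  numer r s q = (1# - q * s) · (poch 1# q r ⊛ poch (s * q) q r)

  denom : ℕ → Carrier → Carrier → Carrier → PS
  denom r s q Y = (poch 1# q r ⊝ ((s * q) · poch (s * q) q r)) ⊛ poch Y q (suc r)

  -- Σ_{w ∈ W_n(r)} s^{dec w} q^{tot w} Y^{single w}, with single given
  -- by the (unique) Lyndon factorization `fact w`.
  sumList : List Carrier → Carrier
  sumList []       = 0#
  sumList (a ∷ as) = a + sumList as

  wordSum : (List ℕ → List Word) → ℕ → Carrier → Carrier → Carrier → PS
  wordSum fact r s q Y n =
    sumList (map (λ w → (s ^R dec w) * ((q ^R tot w) * (Y ^R singles (fact w)))) (words r n))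

module Submission where

open import Defs
open import Level using (Level)
open import Algebra.Bundles using (CommutativeRing)
open import Data.Nat using (ℕ; suc)
open import Data.Nat.Properties using (≤-refl)
open import Data.List using (List)

-- A letter of w is a one-letter factor of its Lyndon factorisation exactly when
-- it is at least every earlier letter and is not a decrease, so all three
-- statistics can be read off w directly.  A word over {0,…,m} factors uniquely
-- as a word over {0,…,m-1}, a peak (empty, or m followed by letters ≤ m ending
-- below m) and a possibly empty run m⋯m, and dec, tot and single add up along
-- this factorisation.  Peaks have no single letters and the run m^k contributes
-- (Y q^m u)^k, so the generating series of the words over {0,…,r} times
-- (uY;q)_{r+1} is the product P_0 ⋯ P_r of the peak series, which does not
-- involve Y.  A nonempty peak factors as a run of m's, all of them decreases, a
-- nonempty word below m and a peak, whence P_m (1 - (g_m - 1) (A_m - 1)) = 1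
-- with g_m = 1/(1 - s q^m u) and A_m the series of words below m at Y = 1.
-- Induction on m, using the product formula at Y = 1, then gives
--   P_0 ⋯ P_m ((u;q)_m - s q (usq;q)_m) = (1 - q s) (u;q)_m (usq;q)_m,
-- which at m = r is the theorem.

module RingSolver where

  open import Level using (0ℓ)
  open import Algebra.Bundles using (CommutativeRing; RawRing)
  open import Algebra.Solver.Ring.AlmostCommutativeRing
    using (fromCommutativeRing; _-Raw-AlmostCommutative⟶_)
  open import Data.Nat using (ℕ; zero; suc)
  import Data.Nat as ℕ
  import Data.Nat.Properties as ℕ
  open import Data.Product using (_,_)
  import Data.Product as Product
  open import Data.Maybe using (Maybe; just; nothing)
  open import Relation.Binary.PropositionalEquality as ≡ using (_≡_)
  open import Relation.Nullary using (yes)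

  -- Integer coefficients for the ring solver: (m , n) stands for m - n, and
  -- `reduce` keeps one side zero, so that equal integers are syntactically equal
  -- and normal forms can be compared by refl.
  Diff : Set
  Diff = ℕ Product.× ℕ

  reduce : ℕ → ℕ → Diff
  reduce (suc m) (suc n) = reduce m n
  reduce zero    n       = zero , n
  reduce (suc m) zero    = suc m , zero

  ℤ-rawRing : RawRing 0ℓ 0ℓ
  ℤ-rawRing = record
    { Carrier = Diff
    ; _≈_     = _≡_
    ; _+_     = λ { (a , b) (c , d) → reduce (a ℕ.+ c) (b ℕ.+ d) }
    ; _*_     = λ { (a , b) (c , d) → reduce (a ℕ.* c ℕ.+ b ℕ.* d) (a ℕ.* d ℕ.+ b ℕ.* c) }
    ; -_      = λ { (a , b) → b , a }
    ; 0#      = 0 , 0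
    ; 1#      = 1 , 0
    }

  module Solver {c ℓ} (R : CommutativeRing c ℓ) where
    open CommutativeRing R hiding (zero)

    private
      module ℤ = RawRing ℤ-rawRing
      open import Relation.Binary.Reasoning.Setoid setoid
      open import Algebra.Properties.Ring ring using (-‿distribˡ-*; -‿distribʳ-*; -‿involutive)
      open import Algebra.Properties.AbelianGroup +-abelianGroup using (⁻¹-∙-comm)
      open import Algebra.Properties.CommutativeSemigroup +-commutativeSemigroup using (interchange)
      open import Algebra.Properties.Semiring.Mult.TCOptimised semiring using (_×_; ×1-homo-*)
      open import Algebra.Properties.Monoid.Mult.TCOptimised +-monoid using (×-homo-+; 1+×)
      open import Algebra.Properties.Group +-group using (ε⁻¹≈ε)

      -- `one` below must evaluate to 1# on the nose, hence the optimised _×_ and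
      -- the special case for n = 0.
      fromDiff : Diff → Carrier
      fromDiff (m , zero)  = m × 1#
      fromDiff (m , suc n) = m × 1# - suc n × 1#

      fromDiff-sub : ∀ m n → fromDiff (m , n) ≈ m × 1# - n × 1#
      fromDiff-sub m zero    = trans (sym (+-identityʳ _)) (+-congˡ (sym ε⁻¹≈ε))
      fromDiff-sub m (suc n) = refl

      sub-+ : ∀ a b c d → (a - b) + (c - d) ≈ (a + c) - (b + d)
      sub-+ a b c d = trans (interchange a (- b) c (- d)) (+-congˡ (⁻¹-∙-comm b d))

      sub-* : ∀ a b c d → (a - b) * (c - d) ≈ (a * c + b * d) - (a * d + b * c)
      sub-* a b c d = begin
        (a - b) * (c - d)                         ≈⟨ distribʳ (c - d) a (- b) ⟩
        a * (c - d) + - b * (c - d)               ≈⟨ +-cong (distribˡ a c (- d)) (distribˡ (- b) c (- d)) ⟩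
        (a * c + a * - d) + (- b * c + - b * - d) ≈⟨ +-cong (+-congˡ (sym (-‿distribʳ-* a d)))
                                                            (+-cong (sym (-‿distribˡ-* b c)) neg*neg) ⟩
        (a * c - a * d) + (- (b * c) + b * d)     ≈⟨ +-congˡ (+-comm _ _) ⟩
        (a * c - a * d) + (b * d - b * c)         ≈⟨ sub-+ (a * c) (a * d) (b * d) (b * c) ⟩
        (a * c + b * d) - (a * d + b * c)         ∎
        where
        neg*neg : - b * - d ≈ b * d
        neg*neg = trans (sym (-‿distribˡ-* b (- d)))
                        (trans (-‿cong (sym (-‿distribʳ-* b d))) (-‿involutive _))

      fromDiff-reduce : ∀ m n → fromDiff (reduce m n) ≈ m × 1# - n × 1#
      fromDiff-reduce (suc m) (suc n) = begin
        fromDiff (reduce m n)                    ≈⟨ fromDiff-reduce m n ⟩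
        m × 1# - n × 1#                          ≈⟨ +-identityˡ _ ⟨
        0# + (m × 1# - n × 1#)                   ≈⟨ +-congʳ (-‿inverseʳ 1#) ⟨
        (1# - 1#) + (m × 1# - n × 1#)            ≈⟨ sub-+ 1# 1# (m × 1#) (n × 1#) ⟩
        (1# + m × 1#) - (1# + n × 1#)            ≈⟨ +-cong (1+× m 1#) (-‿cong (1+× n 1#)) ⟨
        suc m × 1# - suc n × 1#                  ∎
      fromDiff-reduce zero    n       = fromDiff-sub zero n
      fromDiff-reduce (suc m) zero    = fromDiff-sub (suc m) zero

      +-homo : ∀ x y → fromDiff (x ℤ.+ y) ≈ fromDiff x + fromDiff y
      +-homo (a , b) (c , d) = begin
        fromDiff (reduce (a ℕ.+ c) (b ℕ.+ d))     ≈⟨ fromDiff-reduce (a ℕ.+ c) (b ℕ.+ d) ⟩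
        (a ℕ.+ c) × 1# - (b ℕ.+ d) × 1#           ≈⟨ +-cong (×-homo-+ 1# a c) (-‿cong (×-homo-+ 1# b d)) ⟩
        (a × 1# + c × 1#) - (b × 1# + d × 1#)     ≈⟨ sub-+ _ _ _ _ ⟨
        (a × 1# - b × 1#) + (c × 1# - d × 1#)     ≈⟨ +-cong (fromDiff-sub a b) (fromDiff-sub c d) ⟨
        fromDiff (a , b) + fromDiff (c , d)       ∎

      *-homo : ∀ x y → fromDiff (x ℤ.* y) ≈ fromDiff x * fromDiff y
      *-homo (a , b) (c , d) = begin
        fromDiff (reduce (a ℕ.* c ℕ.+ b ℕ.* d) (a ℕ.* d ℕ.+ b ℕ.* c))
          ≈⟨ fromDiff-reduce (a ℕ.* c ℕ.+ b ℕ.* d) (a ℕ.* d ℕ.+ b ℕ.* c) ⟩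
        (a ℕ.* c ℕ.+ b ℕ.* d) × 1# - (a ℕ.* d ℕ.+ b ℕ.* c) × 1#
          ≈⟨ +-cong (sum-of-products a c b d) (-‿cong (sum-of-products a d b c)) ⟩
        (a × 1# * c × 1# + b × 1# * d × 1#) - (a × 1# * d × 1# + b × 1# * c × 1#)
          ≈⟨ sub-* _ _ _ _ ⟨
        (a × 1# - b × 1#) * (c × 1# - d × 1#)
          ≈⟨ *-cong (fromDiff-sub a b) (fromDiff-sub c d) ⟨
        fromDiff (a , b) * fromDiff (c , d) ∎
        where
        sum-of-products : ∀ i j k l → (i ℕ.* j ℕ.+ k ℕ.* l) × 1# ≈ i × 1# * j × 1# + k × 1# * l × 1#
        sum-of-products i j k l =
          trans (×-homo-+ 1# (i ℕ.* j) (k ℕ.* l)) (+-cong (×1-homo-* i j) (×1-homo-* k l))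

      -‿homo : ∀ x → fromDiff (ℤ.- x) ≈ - fromDiff x
      -‿homo (a , b) = begin
        fromDiff (b , a)            ≈⟨ fromDiff-sub b a ⟩
        b × 1# - a × 1#             ≈⟨ +-comm _ _ ⟩
        - (a × 1#) + b × 1#         ≈⟨ +-congˡ (-‿involutive _) ⟨
        - (a × 1#) + - - (b × 1#)   ≈⟨ ⁻¹-∙-comm _ _ ⟩
        - (a × 1# - b × 1#)         ≈⟨ -‿cong (fromDiff-sub a b) ⟨
        - fromDiff (a , b)          ∎

      fromDiff-morphism : ℤ-rawRing -Raw-AlmostCommutative⟶ fromCommutativeRing R
      fromDiff-morphism = record
        { ⟦_⟧    = fromDiff
        ; +-homo = +-homo
        ; *-homo = *-homo
        ; -‿homo = -‿homo
        ; 0-homo = refl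
        ; 1-homo = refl
        }

      _≟ℤ_ : ∀ x y → Maybe (fromDiff x ≈ fromDiff y)
      (a , b) ≟ℤ (c , d) with a ℕ.≟ c | b ℕ.≟ d
      ... | yes ≡.refl | yes ≡.refl = just refl
      ... | _          | _          = nothing

    open import Algebra.Solver.Ring ℤ-rawRing (fromCommutativeRing R) fromDiff-morphism _≟ℤ_ public

    one : ∀ {n} → Polynomial n
    one = con (1 , 0)

module WordStatistics where

  open import Defs
  open import Data.Nat using (ℕ; zero; suc; _+_; _*_; _<_; _≤_; _⊔_; _≤ᵇ_; z≤n)
  open import Data.Nat.Properties
    using (<⇒<ᵇ; <ᵇ⇒<; ≤⇒≤ᵇ; ≤ᵇ⇒≤; ≡⇒≡ᵇ; ≡ᵇ⇒≡; <⇒≯; <⇒≱; <⇒≢; <-irrefl; <⇒≤; ≤-refl;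
           m≤n⇒m<n∨m≡n; m≤n⇒m⊔n≡n; m≥n⇒m⊔n≡m; ⊔-lub; ⊔-idem; +-assoc; +-identityʳ; *-zeroʳ; *-suc)
  open import Data.Bool using (true; false; not; _∧_; if_then_else_; T)
  open import Data.Bool.Properties using (T-≡)
  open import Data.List using ([]; _∷_; _++_; length; replicate)
  open import Data.List.Properties using (++-identityʳ)
  open import Data.List.Relation.Unary.All using (All; []; _∷_)
  open import Data.Empty using (⊥-elim)
  open import Data.Unit using (⊤)
  open import Data.Sum using (_⊎_; inj₁; inj₂)
  open import Function using (_∘_; Equivalence)
  open import Relation.Binary.PropositionalEquality
  open import Relation.Nullary using (¬_)

  private
    true-if : ∀ {b} → T b → b ≡ true
    true-if = Equivalence.to T-≡

    false-if : ∀ {b} → ¬ T b → b ≡ false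
    false-if {false} _  = refl
    false-if {true}  ¬t = ⊥-elim (¬t _)

  isDecAt-desc : ∀ {x y} w → y < x → isDecAt (x ∷ y ∷ w) ≡ true
  isDecAt-desc w y<x rewrite true-if (<⇒<ᵇ y<x) = refl

  isDecAt-asc : ∀ {x y} w → x < y → isDecAt (x ∷ y ∷ w) ≡ false
  isDecAt-asc {x} {y} w x<y
    rewrite false-if (<⇒≯ x<y ∘ <ᵇ⇒< y x) | false-if (<⇒≢ x<y ∘ ≡ᵇ⇒≡ x y) = refl

  isDecAt-flat : ∀ x w → isDecAt (x ∷ x ∷ w) ≡ isDecAt (x ∷ w)
  isDecAt-flat x w rewrite false-if (<-irrefl refl ∘ <ᵇ⇒< x x) | true-if (≡⇒≡ᵇ x x refl) = refl

  nondecRecords : ℕ → Word → ℕ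
  nondecRecords t []      = 0
  nondecRecords t (x ∷ w) = (if (t ≤ᵇ x) ∧ not (isDecAt (x ∷ w)) then 1 else 0) + nondecRecords (t ⊔ x) w

  nondecRecords-below : ∀ {t x} w → x < t → nondecRecords t (x ∷ w) ≡ nondecRecords t w
  nondecRecords-below {t} {x} w x<t
    rewrite false-if (<⇒≱ x<t ∘ ≤ᵇ⇒≤ t x) | m≥n⇒m⊔n≡m (<⇒≤ x<t) = refl

  nondecRecords-decrease : ∀ t {x} w → isDecAt (x ∷ w) ≡ true →
                           nondecRecords t (x ∷ w) ≡ nondecRecords (t ⊔ x) w
  nondecRecords-decrease t {x} w d rewrite d with t ≤ᵇ x
  ... | true  = refl
  ... | false = refl

  nondecRecords-single : ∀ {t x} w → t ≤ x → isDecAt (x ∷ w) ≡ false →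
                         nondecRecords t (x ∷ w) ≡ suc (nondecRecords x w)
  nondecRecords-single w t≤x d rewrite d | true-if (≤⇒≤ᵇ t≤x) | m≤n⇒m⊔n≡n t≤x = refl

  nondecRecords-threshold : ∀ {t y} b → t ≤ y → nondecRecords t (y ∷ b) ≡ nondecRecords 0 (y ∷ b)
  nondecRecords-threshold b t≤y rewrite true-if (≤⇒≤ᵇ t≤y) | m≤n⇒m⊔n≡n t≤y = refl

  data EndsBelow (m : ℕ) : Word → Set where
    last : ∀ {y} → y < m → EndsBelow m (y ∷ [])
    _∷_  : ∀ {x w} → x ≤ m → EndsBelow m w → EndsBelow m (x ∷ w)

  EndsBelow⇒All≤ : ∀ {m w} → EndsBelow m w → All (_≤ m) w
  EndsBelow⇒All≤ (last y<m) = <⇒≤ y<m ∷ []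
  EndsBelow⇒All≤ (x≤m ∷ e) = x≤m ∷ EndsBelow⇒All≤ e

  All<⇒EndsBelow : ∀ {m x w} → All (_< m) (x ∷ w) → EndsBelow m (x ∷ w)
  All<⇒EndsBelow (x<m ∷ [])         = last x<m
  All<⇒EndsBelow (x<m ∷ ps@(_ ∷ _)) = <⇒≤ x<m ∷ All<⇒EndsBelow ps

  All≤-++-EndsBelow : ∀ {m a b} → All (_≤ m) a → EndsBelow m b → EndsBelow m (a ++ b)
  All≤-++-EndsBelow []         e = e
  All≤-++-EndsBelow (x≤m ∷ ps) e = x≤m ∷ All≤-++-EndsBelow ps e

  -- The weakly decreasing run from any position of x ∷ a stops at its last
  -- letter, which is < y.
  isDecAt-++ : ∀ {y x a} b → EndsBelow y (x ∷ a) → isDecAt (x ∷ a ++ y ∷ b) ≡ isDecAt (x ∷ a)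
  isDecAt-++ b (last x<y)          = isDecAt-asc b x<y
  isDecAt-++ {a = _ ∷ _} b (_ ∷ e) rewrite isDecAt-++ b e = refl

  dec-++ : ∀ {y a} b → EndsBelow y a → dec (a ++ y ∷ b) ≡ dec a + dec (y ∷ b)
  dec-++ b (last x<y) rewrite isDecAt-asc b x<y = refl
  dec-++ {y} {x ∷ a} b e@(_ ∷ e′) rewrite isDecAt-++ b e | dec-++ b e′ =
    sym (+-assoc (if isDecAt (x ∷ a) then 1 else 0) (dec a) (dec (y ∷ b)))

  nondecRecords-++ : ∀ {t y a} b → t ≤ y → EndsBelow y a →
                     nondecRecords t (a ++ y ∷ b) ≡ nondecRecords t a + nondecRecords 0 (y ∷ b)
  nondecRecords-++ {t} {y} {x ∷ []} b t≤y (last x<y)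
    rewrite isDecAt-asc b x<y | nondecRecords-threshold b (⊔-lub t≤y (<⇒≤ x<y)) =
    cong (_+ nondecRecords 0 (y ∷ b)) (sym (+-identityʳ (if (t ≤ᵇ x) ∧ true then 1 else 0)))
  nondecRecords-++ {t} {y} {x ∷ a} b t≤y e@(x≤y ∷ e′)
    rewrite isDecAt-++ b e | nondecRecords-++ b (⊔-lub t≤y x≤y) e′ =
    sym (+-assoc (if (t ≤ᵇ x) ∧ not (isDecAt (x ∷ a)) then 1 else 0) _ _)

  isDecAt-EndsBelow : ∀ {m z} rest → EndsBelow m z → isDecAt (m ∷ z ++ rest) ≡ true
  isDecAt-EndsBelow rest (last y<m) = isDecAt-desc rest y<m
  isDecAt-EndsBelow {m} {x ∷ z} rest (x≤m ∷ e) with m≤n⇒m<n∨m≡n x≤m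
  ... | inj₁ x<m  = isDecAt-desc (z ++ rest) x<m
  ... | inj₂ refl = trans (isDecAt-flat m (z ++ rest)) (isDecAt-EndsBelow rest e)

  nondecRecords-EndsBelow : ∀ {m z} rest → EndsBelow m z →
                            nondecRecords m (z ++ rest) ≡ nondecRecords m rest
  nondecRecords-EndsBelow rest (last y<m) = nondecRecords-below rest y<m
  nondecRecords-EndsBelow {m} {x ∷ z} rest (x≤m ∷ e) with m≤n⇒m<n∨m≡n x≤m
  ... | inj₁ x<m  = trans (nondecRecords-below (z ++ rest) x<m) (nondecRecords-EndsBelow rest e)
  ... | inj₂ refl = begin
    nondecRecords m (m ∷ z ++ rest)   ≡⟨ nondecRecords-decrease m (z ++ rest) (isDecAt-EndsBelow rest e) ⟩
    nondecRecords (m ⊔ m) (z ++ rest) ≡⟨ cong (λ t → nondecRecords t (z ++ rest)) (⊔-idem m) ⟩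
    nondecRecords m (z ++ rest)       ≡⟨ nondecRecords-EndsBelow rest e ⟩
    nondecRecords m rest              ∎
    where open ≡-Reasoning

  nondecRecords-peak : ∀ {m z} → EndsBelow m z → nondecRecords 0 (m ∷ z) ≡ 0
  nondecRecords-peak {m} {z} e = begin
    nondecRecords 0 (m ∷ z)      ≡⟨ nondecRecords-decrease 0 z isDecAt-peak ⟩
    nondecRecords m z            ≡⟨ cong (nondecRecords m) (++-identityʳ z) ⟨
    nondecRecords m (z ++ [])    ≡⟨ nondecRecords-EndsBelow [] e ⟩
    0                            ∎
    where
    open ≡-Reasoning
    isDecAt-peak : isDecAt (m ∷ z) ≡ true
    isDecAt-peak = subst (λ w → isDecAt (m ∷ w) ≡ true) (++-identityʳ z) (isDecAt-EndsBelow [] e)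

  isDecAt-replicate : ∀ m n → isDecAt (m ∷ replicate n m) ≡ false
  isDecAt-replicate m zero    = refl
  isDecAt-replicate m (suc n) = trans (isDecAt-flat m (replicate n m)) (isDecAt-replicate m n)

  dec-replicate : ∀ m n → dec (replicate n m) ≡ 0
  dec-replicate m zero    = refl
  dec-replicate m (suc n) rewrite isDecAt-replicate m n = dec-replicate m n

  nondecRecords-replicate : ∀ {t m} n → t ≤ m → nondecRecords t (replicate n m) ≡ n
  nondecRecords-replicate zero    t≤m = refl
  nondecRecords-replicate {m = m} (suc n) t≤m =
    trans (nondecRecords-single (replicate n m) t≤m (isDecAt-replicate m n))
          (cong suc (nondecRecords-replicate n ≤-refl))

  tot-replicate : ∀ m n → tot (replicate n m) ≡ m * n
  tot-replicate m zero    = sym (*-zeroʳ m)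
  tot-replicate m (suc n) = trans (cong (m +_) (tot-replicate m n)) (sym (*-suc m n))

  isDecAt-run : ∀ {m x a y} b → All (_≡ m) (x ∷ a) → y < m → isDecAt (x ∷ a ++ y ∷ b) ≡ true
  isDecAt-run b (refl ∷ []) y<m = isDecAt-desc b y<m
  isDecAt-run {m} {a = _ ∷ a} b (refl ∷ ps@(refl ∷ _)) y<m =
    trans (isDecAt-flat m (a ++ _ ∷ b)) (isDecAt-run b ps y<m)

  dec-run-++ : ∀ {m a y} b → All (_≡ m) a → y < m → dec (a ++ y ∷ b) ≡ length a + dec (y ∷ b)
  dec-run-++ b []            y<m = refl
  dec-run-++ b ps@(_ ∷ ps′) y<m rewrite isDecAt-run b ps y<m = cong suc (dec-run-++ b ps′ y<m)

  Joinable : Word → Word → Set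
  Joinable a []      = ⊤
  Joinable a (y ∷ _) = a ≡ [] ⊎ EndsBelow y a

  All<⇒Joinable : ∀ {y a} b → All (_< y) a → Joinable a (y ∷ b)
  All<⇒Joinable b []         = inj₁ refl
  All<⇒Joinable b ps@(_ ∷ _) = inj₂ (All<⇒EndsBelow ps)

  dec-joinable : ∀ a b → Joinable a b → dec (a ++ b) ≡ dec a + dec b
  dec-joinable a []      _           = trans (cong dec (++-identityʳ a)) (sym (+-identityʳ (dec a)))
  dec-joinable a (y ∷ b) (inj₁ refl) = refl
  dec-joinable a (y ∷ b) (inj₂ e)    = dec-++ b e

  nondecRecords-joinable : ∀ a b → Joinable a b →
                           nondecRecords 0 (a ++ b) ≡ nondecRecords 0 a + nondecRecords 0 b
  nondecRecords-joinable a []      _           =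
    trans (cong (nondecRecords 0) (++-identityʳ a)) (sym (+-identityʳ _))
  nondecRecords-joinable a (y ∷ b) (inj₁ refl) = refl
  nondecRecords-joinable a (y ∷ b) (inj₂ e)    = nondecRecords-++ b z≤n e

module LyndonSingles where

  open import Defs
  open import Data.Nat using (ℕ; suc; _+_; _<_; _≤_; _⊔_; _≡ᵇ_; s≤s; z≤n)
  open import Data.Nat.Properties
    using (<⇒≤; ≤-refl; ≤-reflexive; ≤-trans; <-asym; <-irrefl; <-≤-trans; n≤1+n; m≤m+n; m≤n+m;
           m≤n⇒m<n∨m≡n; m≤n⇒m⊔n≡n; +-comm)
  open import Data.List using (List; []; _∷_; _++_; [_]; length; drop; take; concat)
  open import Data.List.Properties using (length-++)
  open import Data.List.Relation.Unary.All using (All; []; _∷_)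
  open import Data.List.Relation.Unary.Linked as Linked using (Linked; _∷_)
  open import Data.Product using (_×_; _,_; ∃; proj₁; proj₂)
  open import Data.Sum using (_⊎_; inj₁; inj₂)
  open import Data.Empty using (⊥-elim)
  open import Data.Bool using (false)
  open import Relation.Binary.PropositionalEquality using (_≡_; refl; sym; trans; cong; subst; module ≡-Reasoning)
  open import Relation.Nullary using (¬_)
  open WordStatistics

  private
    head-≤ : ∀ {x m a b} → (x ∷ a) ≤L (m ∷ b) → x ≤ m
    head-≤ (<≤ x<m) = <⇒≤ x<m
    head-≤ (≡≤ _)   = ≤-refl

    ≤L-antisym : ∀ {a b} → a ≤L b → b ≤L a → a ≡ b
    ≤L-antisym []≤    []≤    = refl
    ≤L-antisym (<≤ p) (<≤ q) = ⊥-elim (<-asym p q)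
    ≤L-antisym (<≤ p) (≡≤ _) = ⊥-elim (<-irrefl refl p)
    ≤L-antisym (≡≤ _) (<≤ q) = ⊥-elim (<-irrefl refl q)
    ≤L-antisym (≡≤ p) (≡≤ q) = cong (_ ∷_) (≤L-antisym p q)

    drop-length-++ : ∀ {A : Set} (xs ys : List A) → drop (length xs) (xs ++ ys) ≡ ys
    drop-length-++ []       ys = refl
    drop-length-++ (_ ∷ xs) ys = drop-length-++ xs ys

    take-length-++ : ∀ {A : Set} (xs ys : List A) → take (length xs) (xs ++ ys) ≡ xs
    take-length-++ []       ys = refl
    take-length-++ (x ∷ xs) ys = cong (x ∷_) (take-length-++ xs ys)

    All-from-drops : ∀ {P : ℕ → Set} z → (∀ i {x xs} → i < length z → drop i z ≡ x ∷ xs → P x) → All P z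
    All-from-drops []      h = []
    All-from-drops (y ∷ z) h = h 0 (s≤s z≤n) refl ∷ All-from-drops z (λ i i<n → h (suc i) (s≤s i<n))

  -- The rotation starting at a letter x of z begins with x, so x ≤ m.
  lyndon-All≤ : ∀ {m z} → Lyndon (m ∷ z) → All (_≤ m) z
  lyndon-All≤ {m} {z} (_ , rotations<) = All-from-drops z λ i i<n eq →
    head-≤ (subst (λ d → (d ++ take (suc i) (m ∷ z)) ≤L (m ∷ z)) eq
                  (proj₁ (rotations< (suc i) (s≤s z≤n) (s≤s i<n))))

  lyndon-not-ending-in-head : ∀ {m} z → All (_≤ m) z → ¬ Lyndon (m ∷ z ++ [ m ])
  lyndon-not-ending-in-head {m} z z≤m (_ , rotations<) =
    proj₂ last-rotation< (≤L-antisym (proj₁ last-rotation<) (≡≤ (snoc-≤L z z≤m)))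
    where
    snoc-≤L : ∀ z → All (_≤ m) z → (z ++ [ m ]) ≤L (m ∷ z)
    snoc-≤L []      []         = ≡≤ []≤
    snoc-≤L (x ∷ z) (x≤m ∷ ps) with m≤n⇒m<n∨m≡n x≤m
    ... | inj₁ x<m  = <≤ x<m
    ... | inj₂ refl = ≡≤ (snoc-≤L z ps)

    rotation : rot (suc (length z)) (m ∷ z ++ [ m ]) ≡ m ∷ m ∷ z
    rotation rewrite drop-length-++ z [ m ] | take-length-++ z [ m ] = refl

    last-rotation< : (m ∷ m ∷ z) <L (m ∷ z ++ [ m ])
    last-rotation< = subst (_<L (m ∷ z ++ [ m ])) rotation
      (rotations< (suc (length z)) (s≤s z≤n) (s≤s (≤-reflexive (sym (trans (length-++ z) (+-comm (length z) 1))))))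

  endsBelow-or-endsWith : ∀ {m} y z → All (_≤ m) (y ∷ z) →
                     EndsBelow m (y ∷ z) ⊎ ∃ λ z₀ → y ∷ z ≡ z₀ ++ [ m ] × All (_≤ m) z₀
  endsBelow-or-endsWith y [] (y≤m ∷ []) with m≤n⇒m<n∨m≡n y≤m
  ... | inj₁ y<m  = inj₁ (last y<m)
  ... | inj₂ refl = inj₂ ([] , refl , [])
  endsBelow-or-endsWith y (y′ ∷ z) (y≤m ∷ ps) with endsBelow-or-endsWith y′ z ps
  ... | inj₁ e              = inj₁ (y≤m ∷ e)
  ... | inj₂ (z₀ , eq , qs) = inj₂ (y ∷ z₀ , cong (y ∷_) eq , y≤m ∷ qs)

  lyndon-shape : ∀ {m z} → Lyndon (m ∷ z) → z ≡ [] ⊎ EndsBelow m z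
  lyndon-shape {z = []}    _  = inj₁ refl
  lyndon-shape {z = y ∷ z} ly with endsBelow-or-endsWith y z (lyndon-All≤ ly)
  ... | inj₁ e              = inj₂ e
  ... | inj₂ (z₀ , eq , ps) =
    ⊥-elim (lyndon-not-ending-in-head z₀ ps (subst (λ z′ → Lyndon (_ ∷ z′)) eq ly))

  ⪯-head : ∀ {m₁ m₂ a b} → (m₁ ∷ a) ⪯ (m₂ ∷ b) → m₁ ≤ m₂
  ⪯-head (B , pow≤) = head-≤ (pow≤ (suc B) (n≤1+n B))

  -- m m m ⋯ exceeds m ∷ z at the last letter of z at the latest.
  single-⋠ : ∀ {m z} → EndsBelow m z → ¬ ([ m ] ⪯ (m ∷ z))
  single-⋠ {m} {z} e (B , pow≤) with pow≤ (suc (B + length z)) (≤-trans (m≤m+n B (length z)) (n≤1+n _))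
  ... | <≤ m<m = <-irrefl refl m<m
  ... | ≡≤ p  = pow-≰ _ (B + length z) e (m≤n+m (length z) B) p
    where
    pow-≰ : ∀ {z} rest k → EndsBelow m z → length z ≤ k → ¬ (pow k [ m ] ≤L (z ++ rest))
    pow-≰ rest (suc k) (last y<m) _         (<≤ m<y) = <-asym y<m m<y
    pow-≰ rest (suc k) (last y<m) _         (≡≤ _)   = <-irrefl refl y<m
    pow-≰ rest (suc k) (x≤m ∷ e)  _         (<≤ m<x) = <-irrefl refl (<-≤-trans m<x x≤m)
    pow-≰ rest (suc k) (x≤m ∷ e)  (s≤s ≤k) (≡≤ p)   = pow-≰ rest k e ≤k p

  private
    lyndon-nonempty : ∀ {l} → Lyndon l → ∃ λ m → ∃ λ z → l ≡ m ∷ z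
    lyndon-nonempty {m ∷ z} _ = m , z , refl

  -- A one-letter factor m is followed by a larger letter or by another factor [ m ].
  isDecAt-single-factor : ∀ m ls → All Lyndon ls → Linked _⪯_ ([ m ] ∷ ls) → isDecAt (m ∷ concat ls) ≡ false
  isDecAt-single-factor m []       _          _          = refl
  isDecAt-single-factor m (l ∷ ls) (ly ∷ lys) (m⪯l ∷ lk) with lyndon-nonempty ly
  ... | m′ , z , refl with lyndon-shape ly | m≤n⇒m<n∨m≡n (⪯-head m⪯l)
  ...   | _          | inj₁ m<m′ = isDecAt-asc (z ++ concat ls) m<m′
  ...   | inj₁ refl  | inj₂ refl = trans (isDecAt-flat m (concat ls)) (isDecAt-single-factor m ls lys lk)
  ...   | inj₂ e     | inj₂ refl = ⊥-elim (single-⋠ e m⪯l)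

  data HeadsFrom (t : ℕ) : List Word → Set where
    []    : HeadsFrom t []
    first : ∀ {m z ls} → t ≤ m → HeadsFrom t ((m ∷ z) ∷ ls)

  private
    HeadsFrom-next : ∀ {m z ls} → All Lyndon ls → Linked _⪯_ ((m ∷ z) ∷ ls) → HeadsFrom m ls
    HeadsFrom-next []       _          = []
    HeadsFrom-next (ly ∷ _) (l⪯l′ ∷ _) with lyndon-nonempty ly
    ... | _ , _ , refl = first (⪯-head l⪯l′)

    not-single : ∀ {m z} → EndsBelow m z → (length (m ∷ z) ≡ᵇ 1) ≡ false
    not-single (last _) = refl
    not-single (_ ∷ _)  = refl

  singles-concat : ∀ t ls → All Lyndon ls → Linked _⪯_ ls → HeadsFrom t ls →
                   singles ls ≡ nondecRecords t (concat ls)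
  singles-concat t []              _          _  _           = refl
  singles-concat t ((m ∷ z) ∷ ls) (ly ∷ lys) lk (first t≤m) with lyndon-shape ly
  ... | inj₁ refl = trans (cong suc IH)
                          (sym (nondecRecords-single (concat ls) t≤m (isDecAt-single-factor m ls lys lk)))
    where IH = singles-concat m ls lys (Linked.tail lk) (HeadsFrom-next lys lk)
  ... | inj₂ e rewrite not-single e = begin
    singles ls
      ≡⟨ singles-concat m ls lys (Linked.tail lk) (HeadsFrom-next lys lk) ⟩
    nondecRecords m (concat ls)
      ≡⟨ nondecRecords-EndsBelow (concat ls) e ⟨
    nondecRecords m (z ++ concat ls)
      ≡⟨ cong (λ t′ → nondecRecords t′ (z ++ concat ls)) (m≤n⇒m⊔n≡n t≤m) ⟨
    nondecRecords (t ⊔ m) (z ++ concat ls)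
      ≡⟨ nondecRecords-decrease t (z ++ concat ls) (isDecAt-EndsBelow (concat ls) e) ⟨
    nondecRecords t (m ∷ z ++ concat ls) ∎
    where open ≡-Reasoning

  singles≡nondecRecords : ∀ {w ls} → IsLyndonFactorization w ls → singles ls ≡ nondecRecords 0 w
  singles≡nondecRecords {ls = ls} (refl , lys , lk) = singles-concat 0 ls lys lk (heads-from-0 lys)
    where
    heads-from-0 : ∀ {ls} → All Lyndon ls → HeadsFrom 0 ls
    heads-from-0 []       = []
    heads-from-0 (ly ∷ _) with lyndon-nonempty ly
    ... | _ , _ , refl = first z≤n

module Factorisations where

  open import Defs
  open import Level using (0ℓ)
  open import Data.Nat using (ℕ; suc; _<_; _≤_; s≤s; s≤s⁻¹; _<?_; _≤?_)
  open import Data.Nat.Properties using (≤-refl; <⇒≤; m<n⇒m<1+n; m≤n⇒m<n∨m≡n; <-irrefl; <⇒≢; _≟_)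
  open import Data.List using ([]; _∷_; _++_; [_])
  open import Data.List.Properties using (++-identityʳ; ∷-injectiveˡ; ∷-injectiveʳ)
  open import Data.List.Relation.Unary.All as All using (All; []; _∷_; all?)
  open import Data.List.Relation.Unary.All.Properties using (++⁺; ++⁻ˡ)
  open import Data.Product using (_×_; _,_; ∃₂)
  open import Data.Sum using (_⊎_; inj₁; inj₂)
  open import Data.Unit using (⊤; tt)
  open import Data.Empty using (⊥; ⊥-elim)
  open import Relation.Binary.PropositionalEquality using (_≡_; refl; sym; cong₂; subst)
  open import Relation.Nullary using (¬_; yes; no)
  open import Relation.Unary using (Pred; Decidable)
  open import Function using (_∘_)
  open WordStatistics

  record UniqueFactorisation (A B C : Pred Word 0ℓ) : Set where
    field
      factorise : ∀ {w} → C w → ∃₂ λ a b → a ++ b ≡ w × A a × B b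
      combine   : ∀ {a b} → A a → B b → C (a ++ b)
      unique    : ∀ {a b a′ b′} → A a → B b → A a′ → B b′ → a ++ b ≡ a′ ++ b′ → a ≡ a′

  StartsOutside : Pred ℕ 0ℓ → Pred Word 0ℓ
  StartsOutside P []      = ⊤
  StartsOutside P (x ∷ _) = ¬ P x

  prefix-unique : ∀ {P : Pred ℕ 0ℓ} {a a′ b b′} → All P a → All P a′ →
                  StartsOutside P b → StartsOutside P b′ → a ++ b ≡ a′ ++ b′ → a ≡ a′
  prefix-unique []       []        _   _    _    = refl
  prefix-unique []       (px ∷ _)  ¬pb _    refl = ⊥-elim (¬pb px)
  prefix-unique (px ∷ _) []        _   ¬pb′ refl = ⊥-elim (¬pb′ px)
  prefix-unique (_ ∷ pa) (_ ∷ pa′) ¬pb ¬pb′ eq   =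
    cong₂ _∷_ (∷-injectiveˡ eq) (prefix-unique pa pa′ ¬pb ¬pb′ (∷-injectiveʳ eq))

  _⁺ : Pred Word 0ℓ → Pred Word 0ℓ
  (P ⁺) []      = ⊥
  (P ⁺) (x ∷ w) = P (x ∷ w)

  _⁺? : ∀ {P} → Decidable P → Decidable (P ⁺)
  (P? ⁺?) []      = no λ ()
  (P? ⁺?) (x ∷ w) = P? (x ∷ w)

  ⁺⇒ : ∀ {P w} → (P ⁺) w → P w
  ⁺⇒ {w = _ ∷ _} p = p

  Low : ℕ → Pred Word 0ℓ
  Low m = All (_< m)

  Run : ℕ → Pred Word 0ℓ
  Run m = All (_≡ m)

  data Top (m : ℕ) : Pred Word 0ℓ where
    empty : Top m []
    top   : ∀ {w} → Low (suc m) w → Top m (m ∷ w)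

  data Peak (m : ℕ) : Pred Word 0ℓ where
    empty : Peak m []
    peak  : ∀ {z} → EndsBelow m z → Peak m (m ∷ z)

  data Valley (m : ℕ) : Pred Word 0ℓ where
    valley : ∀ {x w} → x < m → EndsBelow m (x ∷ w) → Valley m (x ∷ w)

  low? : ∀ m → Decidable (Low m)
  low? m = all? (_<? m)

  run? : ∀ m → Decidable (Run m)
  run? m = all? (_≟ m)

  endsBelow? : ∀ m → Decidable (EndsBelow m)
  endsBelow? m []          = no λ ()
  endsBelow? m (y ∷ []) with y <? m
  ... | yes y<m = yes (last y<m)
  ... | no  y≮m = no λ { (last y<m) → y≮m y<m ; (_ ∷ ()) }
  endsBelow? m (x ∷ y ∷ w) with x ≤? m | endsBelow? m (y ∷ w)
  ... | yes x≤m | yes e = yes (x≤m ∷ e)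
  ... | no  x≰m | _     = no λ { (x≤m ∷ _) → x≰m x≤m }
  ... | _       | no ¬e = no λ { (_ ∷ e) → ¬e e }

  top? : ∀ m → Decidable (Top m)
  top? m []      = yes empty
  top? m (x ∷ w) with x ≟ m | low? (suc m) w
  ... | yes refl | yes p = yes (top p)
  ... | no  x≢m  | _     = no λ { (top _) → x≢m refl }
  ... | _        | no ¬p = no λ { (top p) → ¬p p }

  peak? : ∀ m → Decidable (Peak m)
  peak? m []      = yes empty
  peak? m (x ∷ z) with x ≟ m | endsBelow? m z
  ... | yes refl | yes e = yes (peak e)
  ... | no  x≢m  | _     = no λ { (peak _) → x≢m refl }
  ... | _        | no ¬e = no λ { (peak e) → ¬e e }

  valley? : ∀ m → Decidable (Valley m)
  valley? m []      = no λ ()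
  valley? m (x ∷ w) with x <? m | endsBelow? m (x ∷ w)
  ... | yes x<m | yes e = yes (valley x<m e)
  ... | no  x≮m | _     = no λ { (valley x<m _) → x≮m x<m }
  ... | _       | no ¬e = no λ { (valley _ e) → ¬e e }

  private
    Run⇒All≤ : ∀ {m w} → Run m w → All (_≤ m) w
    Run⇒All≤ = All.map λ { refl → ≤-refl }

    Run⇒Low : ∀ {m w} → Run m w → Low (suc m) w
    Run⇒Low = All.map s≤s ∘ Run⇒All≤

    Top⇒Low : ∀ {m w} → Top m w → Low (suc m) w
    Top⇒Low empty    = []
    Top⇒Low (top ps) = ≤-refl ∷ ps

    Top-outside : ∀ {m w} → Top m w → StartsOutside (_< m) w
    Top-outside empty   = tt
    Top-outside (top _) = <-irrefl refl

    Peak-outside : ∀ {m w} → Peak m w → StartsOutside (_< m) w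
    Peak-outside empty    = tt
    Peak-outside (peak _) = <-irrefl refl

    Peak⇒EndsBelow : ∀ {m w} → Peak m w → w ≡ [] ⊎ EndsBelow m w
    Peak⇒EndsBelow empty    = inj₁ refl
    Peak⇒EndsBelow (peak e) = inj₂ (≤-refl ∷ e)

    EndsBelow-tail : ∀ {m x w} → EndsBelow m (x ∷ w) → w ≡ [] ⊎ EndsBelow m w
    EndsBelow-tail (last _) = inj₁ refl
    EndsBelow-tail (_ ∷ e)  = inj₂ e

    EndsBelow⇒¬Run : ∀ {m w} → EndsBelow m w → ¬ Run m w
    EndsBelow⇒¬Run (last y<m) (refl ∷ []) = <-irrefl refl y<m
    EndsBelow⇒¬Run (_ ∷ e)    (_ ∷ ps)    = EndsBelow⇒¬Run e ps

    run-suffix-unique : ∀ {m a a′ b b′} → a ≡ [] ⊎ EndsBelow m a → a′ ≡ [] ⊎ EndsBelow m a′ →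
                        Run m b → Run m b′ → a ++ b ≡ a′ ++ b′ → a ≡ a′
    run-suffix-unique (inj₁ refl) (inj₁ refl) _  _   _    = refl
    run-suffix-unique (inj₁ refl) (inj₂ e′)   rb _   refl = ⊥-elim (EndsBelow⇒¬Run e′ (++⁻ˡ _ rb))
    run-suffix-unique (inj₂ e)    (inj₁ refl) _  rb′ refl = ⊥-elim (EndsBelow⇒¬Run e (++⁻ˡ _ rb′))
    run-suffix-unique {a = _ ∷ _} {a′ = _ ∷ _} (inj₂ e) (inj₂ e′) rb rb′ eq =
      cong₂ _∷_ (∷-injectiveˡ eq)
                (run-suffix-unique (EndsBelow-tail e) (EndsBelow-tail e′) rb rb′ (∷-injectiveʳ eq))

    split-low : ∀ {m w} → Low (suc m) w → ∃₂ λ a b → a ++ b ≡ w × Low m a × Top m b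
    split-low [] = [] , [] , refl , [] , empty
    split-low {m} (x<1+m ∷ ps) with m≤n⇒m<n∨m≡n (s≤s⁻¹ x<1+m) | split-low ps
    ... | inj₁ x<m  | a , b , refl , la , tb = _ ∷ a , b , refl , x<m ∷ la , tb
    ... | inj₂ refl | _                      = [] , _ , refl , [] , top ps

    split-run : ∀ {m w} → Low (suc m) w → ∃₂ λ a b → a ++ b ≡ w × (a ≡ [] ⊎ EndsBelow m a) × Run m b
    split-run [] = [] , [] , refl , inj₁ refl , []
    split-run (x<1+m ∷ ps) with split-run ps
    ... | _ ∷ _ , b , refl , inj₁ () , _
    ... | a@(_ ∷ _) , b , refl , inj₂ e , rb = _ ∷ a , b , refl , inj₂ (s≤s⁻¹ x<1+m ∷ e) , rb
    ... | [] , b , refl , _ , rb with m≤n⇒m<n∨m≡n (s≤s⁻¹ x<1+m)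
    ...   | inj₁ x<m  = [ _ ] , b , refl , inj₂ (last x<m) , rb
    ...   | inj₂ refl = [] , _ ∷ b , refl , inj₁ refl , refl ∷ rb

    split-leading-run : ∀ {m w} → EndsBelow m w → ∃₂ λ a b → a ++ b ≡ w × Run m a × Valley m b
    split-leading-run (last y<m) = [] , _ , refl , [] , valley y<m (last y<m)
    split-leading-run e@(x≤m ∷ e′) with m≤n⇒m<n∨m≡n x≤m | split-leading-run e′
    ... | inj₁ x<m  | _                      = [] , _ , refl , [] , valley x<m e
    ... | inj₂ refl | a , b , refl , ra , vb = _ ∷ a , b , refl , refl ∷ ra , vb

    split-below : ∀ {m w} → EndsBelow m w → ∃₂ λ a b → a ++ b ≡ w × Low m a × Peak m b
    split-below (last y<m) = [ _ ] , [] , refl , y<m ∷ [] , empty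
    split-below (x≤m ∷ e) with m≤n⇒m<n∨m≡n x≤m | split-below e
    ... | inj₁ x<m  | a , b , refl , la , pb = _ ∷ a , b , refl , x<m ∷ la , pb
    ... | inj₂ refl | _                      = [] , _ , refl , [] , peak e

  low-top : ∀ m → UniqueFactorisation (Low m) (Top m) (Low (suc m))
  low-top m = record
    { factorise = split-low
    ; combine   = λ la tb → ++⁺ (All.map m<n⇒m<1+n la) (Top⇒Low tb)
    ; unique    = λ la tb la′ tb′ → prefix-unique la la′ (Top-outside tb) (Top-outside tb′)
    }

  peak-run : ∀ m → UniqueFactorisation (Peak m) (Run m) (Top m)
  peak-run m = record
    { factorise = factorise
    ; combine   = combine
    ; unique    = λ pa rb pa′ rb′ → run-suffix-unique (Peak⇒EndsBelow pa) (Peak⇒EndsBelow pa′) rb rb′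
    }
    where
    factorise : ∀ {w} → Top m w → ∃₂ λ a b → a ++ b ≡ w × Peak m a × Run m b
    factorise empty    = [] , [] , refl , empty , []
    factorise (top ps) with split-run ps
    ... | []        , b , refl , _      , rb = [] , m ∷ b , refl , empty , refl ∷ rb
    ... | _ ∷ _     , b , refl , inj₁ () , _
    ... | a@(_ ∷ _) , b , refl , inj₂ e , rb = m ∷ a , b , refl , peak e , rb

    combine : ∀ {a b} → Peak m a → Run m b → Top m (a ++ b)
    combine empty    []          = empty
    combine empty    (refl ∷ rb) = top (Run⇒Low rb)
    combine (peak e) rb          = top (++⁺ (All.map s≤s (EndsBelow⇒All≤ e)) (Run⇒Low rb))

  run-valley : ∀ m → UniqueFactorisation (Run m ⁺) (Valley m) (Peak m ⁺)
  run-valley m = record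
    { factorise = factorise
    ; combine   = λ {a} → combine {a}
    ; unique    = λ {a} {_} {a′} ra vb ra′ vb′ →
        prefix-unique (⁺⇒ {w = a} ra) (⁺⇒ {w = a′} ra′) (Valley-outside vb) (Valley-outside vb′)
    }
    where
    Valley-outside : ∀ {w} → Valley m w → StartsOutside (_≡ m) w
    Valley-outside (valley x<m _) = <⇒≢ x<m

    factorise : ∀ {w} → (Peak m ⁺) w → ∃₂ λ a b → a ++ b ≡ w × (Run m ⁺) a × Valley m b
    factorise {_ ∷ _} (peak e) with split-leading-run e
    ... | a , b , refl , ra , vb = m ∷ a , b , refl , refl ∷ ra , vb

    combine : ∀ {a b} → (Run m ⁺) a → Valley m b → (Peak m ⁺) (a ++ b)
    combine {_ ∷ _} (refl ∷ ra) (valley _ e) = peak (All≤-++-EndsBelow (Run⇒All≤ ra) e)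

  low-peak : ∀ m → UniqueFactorisation (Low m ⁺) (Peak m) (Valley m)
  low-peak m = record
    { factorise = factorise
    ; combine   = λ {a} → combine {a}
    ; unique    = λ {a} {_} {a′} la pb la′ pb′ →
        prefix-unique (⁺⇒ {w = a} la) (⁺⇒ {w = a′} la′) (Peak-outside pb) (Peak-outside pb′)
    }
    where
    factorise : ∀ {w} → Valley m w → ∃₂ λ a b → a ++ b ≡ w × (Low m ⁺) a × Peak m b
    factorise (valley x<m (last _)) = [ _ ] , [] , refl , x<m ∷ [] , empty
    factorise (valley x<m (_ ∷ e)) with split-below e
    ... | a , b , refl , la , pb = _ ∷ a , b , refl , x<m ∷ la , pb

    combine : ∀ {a b} → (Low m ⁺) a → Peak m b → Valley m (a ++ b)
    combine {x ∷ a} la@(x<m ∷ _) empty =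
      valley x<m (subst (λ w → EndsBelow m (x ∷ w)) (sym (++-identityʳ a)) (All<⇒EndsBelow la))
    combine {_ ∷ _} la@(x<m ∷ _) (peak e) =
      valley x<m (All≤-++-EndsBelow (All.map <⇒≤ la) (≤-refl ∷ e))

  low-top-joinable : ∀ {m a b} → Low m a → Top m b → Joinable a b
  low-top-joinable la empty       = tt
  low-top-joinable la (top {w} _) = All<⇒Joinable w la

  peak-run-joinable : ∀ {m a b} → Peak m a → Run m b → Joinable a b
  peak-run-joinable _        []         = tt
  peak-run-joinable empty    (refl ∷ _) = inj₁ refl
  peak-run-joinable (peak e) (refl ∷ _) = inj₂ (≤-refl ∷ e)

  low-peak-joinable : ∀ {m a b} → Low m a → Peak m b → Joinable a b
  low-peak-joinable la empty         = tt
  low-peak-joinable la (peak {z} _) = All<⇒Joinable z la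

module PowerSeriesRing {c ℓ} (R : CommutativeRing c ℓ) where
  open import Defs
  open import Algebra.Bundles using (CommutativeRing)
  import Algebra.Construct.Pointwise as Pointwise
  open import Data.Nat using (ℕ; zero; suc)
  open import Data.Product using (_,_)

  open CommutativeRing R
  open Series R using (PS; _^R_; sumTo; _⊛_; _·_; oneS; lin; poch)
  open import Relation.Binary.Reasoning.Setoid setoid
  open import Algebra.Properties.CommutativeSemigroup +-commutativeSemigroup using (interchange; x∙yz≈y∙xz)
  open import Algebra.Properties.Group +-group using (ε⁻¹≈ε)
  open import Algebra.Properties.Ring ring using (-‿distribˡ-*)

  infix  4 _≋_
  infixl 6 _⊕_ _⊖_
  infixl 7 _⊗_

  _≋_ : PS → PS → Set ℓ
  f ≋ g = ∀ n → f n ≈ g n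

  _⊕_ : PS → PS → PS
  (f ⊕ g) n = f n + g n

  ⊖_ : PS → PS
  (⊖ f) n = - f n

  _⊖_ : PS → PS → PS
  f ⊖ g = f ⊕ ⊖ g

  0S : PS
  0S _ = 0#

  shift : PS → PS
  shift f n = f (suc n)

  -- The Cauchy product by recursion on the degree, which is easier to reason
  -- about than the explicit sum in `_⊛_`.
  _⊗_ : PS → PS → PS
  (f ⊗ g) zero    = f 0 * g 0
  (f ⊗ g) (suc n) = f 0 * g (suc n) + (shift f ⊗ g) n

  ⊗-cong : ∀ {f f′ g g′} → f ≋ f′ → g ≋ g′ → f ⊗ g ≋ f′ ⊗ g′
  ⊗-cong f≋ g≋ zero    = *-cong (f≋ 0) (g≋ 0)
  ⊗-cong f≋ g≋ (suc n) = +-cong (*-cong (f≋ 0) (g≋ (suc n))) (⊗-cong (λ k → f≋ (suc k)) g≋ n)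

  ⊗-zeroˡ : ∀ g → 0S ⊗ g ≋ 0S
  ⊗-zeroˡ g zero    = zeroˡ _
  ⊗-zeroˡ g (suc n) = trans (+-cong (zeroˡ _) (⊗-zeroˡ g n)) (+-identityˡ _)

  ⊗-identityˡ : ∀ g → oneS ⊗ g ≋ g
  ⊗-identityˡ g zero    = *-identityˡ _
  ⊗-identityˡ g (suc n) = trans (+-cong (*-identityˡ _) (⊗-zeroˡ g n)) (+-identityʳ _)

  ⊗-comm : ∀ f g → f ⊗ g ≋ g ⊗ f
  ⊗-comm f g zero          = *-comm _ _
  ⊗-comm f g (suc zero)    = trans (+-cong (*-comm _ _) (*-comm _ _)) (+-comm _ _)
  ⊗-comm f g (suc (suc n)) = begin
    f 0 * g (suc (suc n)) + (shift f ⊗ g) (suc n)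
      ≈⟨ +-congˡ (trans (⊗-comm (shift f) g (suc n)) (+-congˡ (⊗-comm (shift g) (shift f) n))) ⟩
    f 0 * g (suc (suc n)) + (g 0 * f (suc (suc n)) + (shift f ⊗ shift g) n)
      ≈⟨ x∙yz≈y∙xz _ _ _ ⟩
    g 0 * f (suc (suc n)) + (f 0 * g (suc (suc n)) + (shift f ⊗ shift g) n)
      ≈⟨ +-congˡ (⊗-comm f (shift g) (suc n)) ⟩
    g 0 * f (suc (suc n)) + (shift g ⊗ f) (suc n) ∎

  ⊗-distribʳ : ∀ f g h → (f ⊕ g) ⊗ h ≋ f ⊗ h ⊕ g ⊗ h
  ⊗-distribʳ f g h zero    = distribʳ _ _ _
  ⊗-distribʳ f g h (suc n) =
    trans (+-cong (distribʳ _ _ _) (⊗-distribʳ (shift f) (shift g) h n)) (interchange _ _ _ _)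

  ⊗-distribˡ : ∀ f g h → f ⊗ (g ⊕ h) ≋ f ⊗ g ⊕ f ⊗ h
  ⊗-distribˡ f g h n = begin
    (f ⊗ (g ⊕ h)) n       ≈⟨ ⊗-comm f (g ⊕ h) n ⟩
    ((g ⊕ h) ⊗ f) n       ≈⟨ ⊗-distribʳ g h f n ⟩
    (g ⊗ f) n + (h ⊗ f) n ≈⟨ +-cong (⊗-comm g f n) (⊗-comm h f n) ⟩
    (f ⊗ g) n + (f ⊗ h) n ∎

  ⊗-·ˡ : ∀ a f g → (a · f) ⊗ g ≋ a · (f ⊗ g)
  ⊗-·ˡ a f g zero    = *-assoc _ _ _
  ⊗-·ˡ a f g (suc n) = trans (+-cong (*-assoc _ _ _) (⊗-·ˡ a (shift f) g n)) (sym (distribˡ _ _ _))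

  ⊗-assoc : ∀ f g h → (f ⊗ g) ⊗ h ≋ f ⊗ (g ⊗ h)
  ⊗-assoc f g h zero    = *-assoc _ _ _
  ⊗-assoc f g h (suc n) = begin
    (f 0 * g 0) * h (suc n) + (shift (f ⊗ g) ⊗ h) n
      ≈⟨ +-congˡ (⊗-distribʳ (f 0 · shift g) (shift f ⊗ g) h n) ⟩
    (f 0 * g 0) * h (suc n) + (((f 0 · shift g) ⊗ h) n + ((shift f ⊗ g) ⊗ h) n)
      ≈⟨ +-congˡ (+-cong (⊗-·ˡ (f 0) (shift g) h n) (⊗-assoc (shift f) g h n)) ⟩
    (f 0 * g 0) * h (suc n) + (f 0 * (shift g ⊗ h) n + (shift f ⊗ (g ⊗ h)) n)
      ≈⟨ +-assoc _ _ _ ⟨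
    ((f 0 * g 0) * h (suc n) + f 0 * (shift g ⊗ h) n) + (shift f ⊗ (g ⊗ h)) n
      ≈⟨ +-congʳ (trans (+-congʳ (*-assoc _ _ _)) (sym (distribˡ _ _ _))) ⟩
    f 0 * (g ⊗ h) (suc n) + (shift f ⊗ (g ⊗ h)) n ∎

  powerSeriesRing : CommutativeRing c ℓ
  powerSeriesRing = record
    { Carrier           = PS
    ; _≈_               = _≋_
    ; _+_               = _⊕_
    ; _*_               = _⊗_
    ; -_                = ⊖_
    ; 0#                = 0S
    ; 1#                = oneS
    ; isCommutativeRing = record
      { isRing = record
        { +-isAbelianGroup = Pointwise.isAbelianGroup ℕ +-isAbelianGroup
        ; *-cong           = ⊗-cong
        ; *-assoc          = ⊗-assoc
        ; *-identity       = ⊗-identityˡ , λ g n → trans (⊗-comm g oneS n) (⊗-identityˡ g n)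
        ; distrib          = ⊗-distribˡ , λ f g h → ⊗-distribʳ g h f
        }
      ; *-comm = ⊗-comm
      }
    }

  sumTo-suc : ∀ m h → sumTo (suc m) h ≈ h 0 + sumTo m (λ k → h (suc k))
  sumTo-suc zero    h = trans (+-identityˡ _) (sym (+-identityʳ _))
  sumTo-suc (suc m) h = trans (+-congʳ (sumTo-suc m h)) (+-assoc _ _ _)

  ⊛≈⊗ : ∀ f g n → (f ⊛ g) n ≈ (f ⊗ g) n
  ⊛≈⊗ f g zero    = +-identityˡ _
  ⊛≈⊗ f g (suc n) = trans (sumTo-suc (suc n) _) (+-congˡ (⊛≈⊗ (shift f) g n))

  C : Carrier → PS
  C a zero    = a
  C a (suc n) = 0#

  X : PS
  X zero          = 0#
  X (suc zero)    = 1#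
  X (suc (suc n)) = 0#

  geom : Carrier → PS
  geom a n = a ^R n

  ·≋C⊗ : ∀ a f → a · f ≋ C a ⊗ f
  ·≋C⊗ a f zero    = refl
  ·≋C⊗ a f (suc n) = sym (trans (+-congˡ (⊗-zeroˡ f n)) (+-identityʳ _))

  C-1 : C 1# ≋ oneS
  C-1 zero    = refl
  C-1 (suc n) = refl

  C-* : ∀ a b → C (a * b) ≋ C a ⊗ C b
  C-* a b zero    = refl
  C-* a b (suc n) = sym (trans (+-cong (zeroʳ a) (⊗-zeroˡ (C b) n)) (+-identityʳ _))

  C-‿ : ∀ a b → C (a - b) ≋ C a ⊖ C b
  C-‿ a b zero    = refl
  C-‿ a b (suc n) = sym (-‿inverseʳ 0#)

  C-cong : ∀ {a b} → a ≈ b → C a ≋ C b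
  C-cong a≈b zero    = a≈b
  C-cong a≈b (suc n) = refl

  lin≋ : ∀ a → lin a ≋ oneS ⊖ C a ⊗ X
  lin≋ a zero          = sym (trans (+-congˡ (trans (-‿cong (zeroʳ a)) ε⁻¹≈ε)) (+-identityʳ _))
  lin≋ a (suc zero)    =
    sym (trans (+-identityˡ _) (-‿cong (trans (+-cong (*-identityʳ a) (zeroˡ _)) (+-identityʳ _))))
  lin≋ a (suc (suc n)) =
    sym (trans (+-identityˡ _) (trans (-‿cong (trans (+-cong (zeroʳ a) (⊗-zeroˡ X (suc n))) (+-identityʳ _))) ε⁻¹≈ε))

  lin-cong : ∀ {a b} → a ≈ b → lin a ≋ lin b
  lin-cong a≈b zero          = refl
  lin-cong a≈b (suc zero)    = -‿cong a≈b
  lin-cong a≈b (suc (suc n)) = refl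

  geom⊗lin : ∀ a → geom a ⊗ lin a ≋ oneS
  geom⊗lin a n = trans (⊗-comm (geom a) (lin a) n) (lin⊗geom n)
    where
    lin⊗geom : ∀ n → (lin a ⊗ geom a) n ≈ oneS n
    lin⊗geom zero    = *-identityˡ _
    lin⊗geom (suc zero) = begin
      1# * (a * 1#) + - a * 1#   ≈⟨ +-cong (*-identityˡ _) (sym (-‿distribˡ-* a 1#)) ⟩
      a * 1# - a * 1#            ≈⟨ -‿inverseʳ _ ⟩
      0#                         ∎
    lin⊗geom (suc (suc n)) = begin
      1# * (a * (a * (a ^R n))) + (- a * (a * (a ^R n)) + (shift (shift (lin a)) ⊗ geom a) n)
        ≈⟨ +-cong (*-identityˡ _) (+-congˡ (⊗-zeroˡ (geom a) n)) ⟩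
      a * (a * (a ^R n)) + (- a * (a * (a ^R n)) + 0#)
        ≈⟨ +-congˡ (trans (+-identityʳ _) (sym (-‿distribˡ-* a _))) ⟩
      a * (a * (a ^R n)) - a * (a * (a ^R n))
        ≈⟨ -‿inverseʳ _ ⟩
      0# ∎

module WordSeries {c ℓ} (R : CommutativeRing c ℓ) (r : ℕ) where
  open import Defs
  open import Level using (0ℓ)
  open import Algebra.Bundles using (CommutativeRing)
  open import Data.Nat using (ℕ; zero; suc; _<_; _≤_; s≤s)
  open import Data.Nat.Properties using (suc-injective)
  open import Data.List using (List; []; _∷_; _++_; map; concatMap; upTo; applyUpTo; replicate)
  open import Data.List.Properties using (map-applyUpTo; ∷-injectiveʳ)
  open import Data.List.Membership.Propositional using (_∈_)
  open import Data.List.Membership.Propositional.Properties using (∈-upTo⁻)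
  open import Data.List.Relation.Unary.Any using (here; there)
  open import Data.List.Relation.Unary.All using ([]; _∷_)
  open import Data.Product using (_,_)
  open import Data.Empty using (⊥; ⊥-elim)
  open import Function using (_∘_)
  open import Relation.Binary.PropositionalEquality as ≡ using (_≡_; _≢_)
  open import Relation.Nullary using (¬_; Dec; yes; no)
  open import Relation.Unary using (Pred; Decidable)
  open WordStatistics
  open Factorisations

  open CommutativeRing R
  open Series R using (PS; sumList; oneS)
  open PowerSeriesRing R
  open import Relation.Binary.Reasoning.Setoid setoid
  open import Algebra.Properties.CommutativeSemigroup +-commutativeSemigroup using (interchange)

  sumOver : ∀ {A : Set} → List A → (A → Carrier) → Carrier
  sumOver xs h = sumList (map h xs)

  sumOver-cong : ∀ {A : Set} (xs : List A) {h h′} → (∀ {x} → x ∈ xs → h x ≈ h′ x) → sumOver xs h ≈ sumOver xs h′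
  sumOver-cong []       h≈ = refl
  sumOver-cong (x ∷ xs) h≈ = +-cong (h≈ (here ≡.refl)) (sumOver-cong xs (h≈ ∘ there))

  sumOver-++ : ∀ {A : Set} (xs ys : List A) h → sumOver (xs ++ ys) h ≈ sumOver xs h + sumOver ys h
  sumOver-++ []       ys h = sym (+-identityˡ _)
  sumOver-++ (x ∷ xs) ys h = trans (+-congˡ (sumOver-++ xs ys h)) (sym (+-assoc _ _ _))

  sumOver-concatMap : ∀ {A B : Set} (f : A → List B) xs h →
                      sumOver (concatMap f xs) h ≈ sumOver xs (λ x → sumOver (f x) h)
  sumOver-concatMap f []       h = refl
  sumOver-concatMap f (x ∷ xs) h = trans (sumOver-++ (f x) (concatMap f xs) h) (+-congˡ (sumOver-concatMap f xs h))

  sumOver-map : ∀ {A B : Set} (g : A → B) xs h → sumOver (map g xs) h ≡ sumOver xs (h ∘ g)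
  sumOver-map g []       h = ≡.refl
  sumOver-map g (x ∷ xs) h = ≡.cong (h (g x) +_) (sumOver-map g xs h)

  sumOver-+ : ∀ {A : Set} (xs : List A) h h′ → sumOver xs (λ x → h x + h′ x) ≈ sumOver xs h + sumOver xs h′
  sumOver-+ []       h h′ = sym (+-identityˡ _)
  sumOver-+ (x ∷ xs) h h′ = trans (+-congˡ (sumOver-+ xs h h′)) (interchange _ _ _ _)

  sumOver-*ˡ : ∀ {A : Set} (xs : List A) a h → a * sumOver xs h ≈ sumOver xs (λ x → a * h x)
  sumOver-*ˡ []       a h = zeroʳ a
  sumOver-*ˡ (x ∷ xs) a h = trans (distribˡ _ _ _) (+-congˡ (sumOver-*ˡ xs a h))

  sumOver-zero : ∀ {A : Set} (xs : List A) {h} → (∀ x → h x ≈ 0#) → sumOver xs h ≈ 0#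
  sumOver-zero []       h≈0 = refl
  sumOver-zero (x ∷ xs) h≈0 = trans (+-cong (h≈0 x) (sumOver-zero xs h≈0)) (+-identityˡ _)

  sumOver-upTo-single : ∀ k {j h} → j < k → (∀ i → i ≢ j → h i ≈ 0#) → sumOver (upTo k) h ≈ h j
  sumOver-upTo-single k {h = h} j<k h≈0 =
    trans (reflexive (≡.cong sumList (map-applyUpTo (λ i → i) h k))) (single h k j<k h≈0)
    where
    zeros : ∀ g k → (∀ i → g i ≈ 0#) → sumList (applyUpTo g k) ≈ 0#
    zeros g zero    _   = refl
    zeros g (suc k) g≈0 = trans (+-cong (g≈0 0) (zeros (g ∘ suc) k (g≈0 ∘ suc))) (+-identityˡ _)

    single : ∀ g k {j} → j < k → (∀ i → i ≢ j → g i ≈ 0#) → sumList (applyUpTo g k) ≈ g j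
    single g (suc k) {zero}  _          g≈0 =
      trans (+-congˡ (zeros (g ∘ suc) k λ i → g≈0 (suc i) λ ())) (+-identityʳ _)
    single g (suc k) {suc j} (s≤s j<k) g≈0 =
      trans (+-cong (g≈0 0 λ ()) (single (g ∘ suc) k j<k λ i i≢j → g≈0 (suc i) (i≢j ∘ suc-injective)))
            (+-identityˡ _)

  wordSeries : (Word → Carrier) → PS
  wordSeries F n = sumOver (words r n) F

  wordSeries-suc : ∀ F n → wordSeries F (suc n) ≈ sumOver (upTo (suc r)) (λ x → wordSeries (F ∘ (x ∷_)) n)
  wordSeries-suc F n = begin
    sumOver (concatMap (λ x → map (x ∷_) (words r n)) (upTo (suc r))) F
      ≈⟨ sumOver-concatMap (λ x → map (x ∷_) (words r n)) (upTo (suc r)) F ⟩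
    sumOver (upTo (suc r)) (λ x → sumOver (map (x ∷_) (words r n)) F)
      ≈⟨ sumOver-cong (upTo (suc r)) (λ {x} _ → reflexive (sumOver-map (x ∷_) (words r n) F)) ⟩
    sumOver (upTo (suc r)) (λ x → wordSeries (F ∘ (x ∷_)) n) ∎

  wordSeries-cong : ∀ {F G} → (∀ w → F w ≈ G w) → wordSeries F ≋ wordSeries G
  wordSeries-cong F≈G n = sumOver-cong (words r n) (λ {w} _ → F≈G w)

  ⊗-sumOver : ∀ {A : Set} (xs : List A) (F : A → PS) g n →
              ((λ k → sumOver xs (λ x → F x k)) ⊗ g) n ≈ sumOver xs (λ x → (F x ⊗ g) n)
  ⊗-sumOver []       F g n = ⊗-zeroˡ g n
  ⊗-sumOver (x ∷ xs) F g n =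
    trans (⊗-distribʳ (F x) (λ k → sumOver xs (λ y → F y k)) g n) (+-congˡ (⊗-sumOver xs F g n))

  -- Σ_{a ++ b ≡ w} G a b
  splitSum : Word → (Word → Word → Carrier) → Carrier
  splitSum []      G = G [] []
  splitSum (x ∷ w) G = G [] (x ∷ w) + splitSum w (λ a b → G (x ∷ a) b)

  splitSum-zero : ∀ w G → (∀ a b → a ++ b ≡ w → G a b ≈ 0#) → splitSum w G ≈ 0#
  splitSum-zero []      G G≈0 = G≈0 [] [] ≡.refl
  splitSum-zero (x ∷ w) G G≈0 =
    trans (+-cong (G≈0 [] (x ∷ w) ≡.refl) (splitSum-zero w _ λ a b eq → G≈0 (x ∷ a) b (≡.cong (x ∷_) eq)))
          (+-identityˡ _)

  splitSum-single : ∀ a₀ b₀ G → (∀ a b → a ++ b ≡ a₀ ++ b₀ → a ≢ a₀ → G a b ≈ 0#) →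
                    splitSum (a₀ ++ b₀) G ≈ G a₀ b₀
  splitSum-single [] [] G G≈0 = refl
  splitSum-single [] (y ∷ b₀) G G≈0 =
    trans (+-congˡ (splitSum-zero b₀ _ λ a b eq → G≈0 (y ∷ a) b (≡.cong (y ∷_) eq) λ ())) (+-identityʳ _)
  splitSum-single (x ∷ a₀) b₀ G G≈0 = begin
    G [] (x ∷ a₀ ++ b₀) + splitSum (a₀ ++ b₀) (λ a b → G (x ∷ a) b)
      ≈⟨ +-congʳ (G≈0 [] _ ≡.refl λ ()) ⟩
    0# + splitSum (a₀ ++ b₀) (λ a b → G (x ∷ a) b)
      ≈⟨ +-identityˡ _ ⟩
    splitSum (a₀ ++ b₀) (λ a b → G (x ∷ a) b)
      ≈⟨ splitSum-single a₀ b₀ _ (λ a b eq a≢a₀ → G≈0 (x ∷ a) b (≡.cong (x ∷_) eq) (a≢a₀ ∘ ∷-injectiveʳ)) ⟩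
    G (x ∷ a₀) b₀ ∎

  wordSeries-⊗ : ∀ A B → wordSeries A ⊗ wordSeries B ≋ wordSeries (λ w → splitSum w (λ a b → A a * B b))
  wordSeries-⊗ A B zero    = trans (*-cong (+-identityʳ _) (+-identityʳ _)) (sym (+-identityʳ _))
  wordSeries-⊗ A B (suc n) = begin
    wordSeries A 0 * wordSeries B (suc n) + (shift (wordSeries A) ⊗ wordSeries B) n
      ≈⟨ +-cong (*-cong (+-identityʳ _) (wordSeries-suc B n)) (⊗-cong (wordSeries-suc A) (λ _ → refl) n) ⟩
    A [] * sumOver U (λ x → wordSeries (B ∘ (x ∷_)) n)
      + ((λ k → sumOver U (λ x → wordSeries (A ∘ (x ∷_)) k)) ⊗ wordSeries B) n
      ≈⟨ +-cong (sumOver-*ˡ U (A []) _) (⊗-sumOver U (λ x → wordSeries (A ∘ (x ∷_))) (wordSeries B) n) ⟩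
    sumOver U (λ x → A [] * wordSeries (B ∘ (x ∷_)) n)
      + sumOver U (λ x → (wordSeries (A ∘ (x ∷_)) ⊗ wordSeries B) n)
      ≈⟨ +-cong (sumOver-cong U λ _ → sumOver-*ˡ (words r n) (A []) _)
                (sumOver-cong U λ {x} _ → wordSeries-⊗ (A ∘ (x ∷_)) B n) ⟩
    sumOver U (λ x → wordSeries (λ w → A [] * B (x ∷ w)) n)
      + sumOver U (λ x → wordSeries (λ w → splitSum w (λ a b → A (x ∷ a) * B b)) n)
      ≈⟨ sumOver-+ U _ _ ⟨
    sumOver U (λ x → wordSeries (λ w → A [] * B (x ∷ w)) n
                     + wordSeries (λ w → splitSum w (λ a b → A (x ∷ a) * B b)) n)
      ≈⟨ sumOver-cong U (λ _ → sumOver-+ (words r n) _ _) ⟨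
    sumOver U (λ x → wordSeries (λ w → splitSum (x ∷ w) (λ a b → A a * B b)) n)
      ≈⟨ wordSeries-suc _ n ⟨
    wordSeries (λ w → splitSum w (λ a b → A a * B b)) (suc n) ∎
    where
    U = upTo (suc r)

  indicator : ∀ {P : Set} → Dec P → Carrier → Carrier
  indicator (yes _) v = v
  indicator (no _)  v = 0#

  indicator-yes : ∀ {P : Set} (p? : Dec P) {v} → P → indicator p? v ≈ v
  indicator-yes (yes _) _ = refl
  indicator-yes (no ¬p) p = ⊥-elim (¬p p)

  indicator-no : ∀ {P : Set} (p? : Dec P) {v} → ¬ P → indicator p? v ≈ 0#
  indicator-no (yes p) ¬p = ⊥-elim (¬p p)
  indicator-no (no _)  _  = refl

  indicator-⇔ : ∀ {P Q : Set} (p? : Dec P) (q? : Dec Q) {v} → (P → Q) → (Q → P) → indicator p? v ≈ indicator q? v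
  indicator-⇔ (yes p) q? P⇒Q _   = sym (indicator-yes q? (P⇒Q p))
  indicator-⇔ (no ¬p) q? _   Q⇒P = sym (indicator-no q? (¬p ∘ Q⇒P))

  gf : ∀ {P : Pred Word 0ℓ} → Decidable P → (Word → Carrier) → PS
  gf P? F = wordSeries (λ w → indicator (P? w) (F w))

  gf-cong : ∀ {P} (P? : Decidable P) {F G} → (∀ {w} → P w → F w ≈ G w) → gf P? F ≋ gf P? G
  gf-cong P? {F} {G} F≈G = wordSeries-cong term
    where
    term : ∀ w → indicator (P? w) (F w) ≈ indicator (P? w) (G w)
    term w with P? w
    ... | yes p = F≈G p
    ... | no _  = refl

  gf-product : ∀ {A B C} (A? : Decidable A) (B? : Decidable B) (C? : Decidable C) {F G H} →
               UniqueFactorisation A B C → (∀ {a b} → A a → B b → F a * G b ≈ H (a ++ b)) →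
               gf A? F ⊗ gf B? G ≋ gf C? H
  gf-product {A} {B} {C} A? B? C? {F} {G} {H} fact F*G≈H n =
    trans (wordSeries-⊗ _ _ n) (sumOver-cong (words r n) λ {w} _ → splitSum-indicator w)
    where
    open UniqueFactorisation fact

    term : Word → Word → Carrier
    term a b = indicator (A? a) (F a) * indicator (B? b) (G b)

    term-zero : ∀ a b → (A a → B b → ⊥) → term a b ≈ 0#
    term-zero a b ¬AB with A? a | B? b
    ... | yes pa | yes pb = ⊥-elim (¬AB pa pb)
    ... | yes _  | no _   = zeroʳ _
    ... | no _   | _      = zeroˡ _

    splitSum-indicator : ∀ w → splitSum w term ≈ indicator (C? w) (H w)
    splitSum-indicator w with C? w
    ... | no ¬c = splitSum-zero w term λ a b eq → term-zero a b λ pa pb → ¬c (≡.subst C eq (combine pa pb))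
    ... | yes c with factorise c
    ...   | a₀ , b₀ , ≡.refl , pa₀ , pb₀ = begin
      splitSum (a₀ ++ b₀) term ≈⟨ splitSum-single a₀ b₀ term others ⟩
      term a₀ b₀               ≈⟨ *-cong (indicator-yes (A? a₀) pa₀) (indicator-yes (B? b₀) pb₀) ⟩
      F a₀ * G b₀              ≈⟨ F*G≈H pa₀ pb₀ ⟩
      H (a₀ ++ b₀)             ∎
      where
      others : ∀ a b → a ++ b ≡ a₀ ++ b₀ → a ≢ a₀ → term a b ≈ 0#
      others a b eq a≢a₀ = term-zero a b λ pa pb → a≢a₀ (unique pa pb pa₀ pb₀ eq)

  gf-⁺ : ∀ {P} (P? : Decidable P) {F} → P [] → F [] ≈ 1# → gf P? F ≋ oneS ⊕ gf (P? ⁺?) F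
  gf-⁺ P? p[] F[]≈1 zero    =
    trans (+-identityʳ _) (trans (trans (indicator-yes (P? []) p[]) F[]≈1)
                                 (sym (trans (+-congˡ (+-identityʳ 0#)) (+-identityʳ 1#))))
  gf-⁺ P? p[] F[]≈1 (suc n) = trans (wordSeries-suc _ n) (trans (sym (wordSeries-suc _ n)) (sym (+-identityˡ _)))

  gf-low-zero : ∀ {F} → F [] ≈ 1# → gf (low? 0) F ≋ oneS
  gf-low-zero F[]≈1 zero    = trans (+-identityʳ _) F[]≈1
  gf-low-zero {F} F[]≈1 (suc n) =
    trans (wordSeries-suc _ n) (sumOver-zero (upTo (suc r)) λ x → sumOver-zero (words r n) λ w →
      indicator-no (low? 0 (x ∷ w)) {F (x ∷ w)} λ { (() ∷ _) })

  gf-all : ∀ F → gf (low? (suc r)) F ≋ wordSeries F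
  gf-all F zero    = refl
  gf-all F (suc n) = begin
    gf (low? (suc r)) F (suc n)
      ≈⟨ wordSeries-suc _ n ⟩
    sumOver (upTo (suc r)) (λ x → wordSeries (λ w → indicator (low? (suc r) (x ∷ w)) (F (x ∷ w))) n)
      ≈⟨ sumOver-cong (upTo (suc r)) (λ {x} x∈ → trans (wordSeries-cong (λ w →
           indicator-⇔ (low? (suc r) (x ∷ w)) (low? (suc r) w) (λ { (_ ∷ p) → p }) (∈-upTo⁻ x∈ ∷_)) n)
           (gf-all _ n)) ⟩
    sumOver (upTo (suc r)) (λ x → wordSeries (F ∘ (x ∷_)) n)
      ≈⟨ wordSeries-suc F n ⟨
    wordSeries F (suc n) ∎

  gf-run : ∀ {m} → m ≤ r → ∀ F n → gf (run? m) F n ≈ F (replicate n m)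
  gf-run m≤r F zero    = +-identityʳ _
  gf-run {m} m≤r F (suc n) = begin
    gf (run? m) F (suc n)
      ≈⟨ wordSeries-suc _ n ⟩
    sumOver (upTo (suc r)) (λ x → wordSeries (λ w → indicator (run? m (x ∷ w)) (F (x ∷ w))) n)
      ≈⟨ sumOver-upTo-single (suc r) (s≤s m≤r) (λ x x≢m →
           sumOver-zero (words r n) λ w → indicator-no (run? m (x ∷ w)) λ { (x≡m ∷ _) → x≢m x≡m }) ⟩
    wordSeries (λ w → indicator (run? m (m ∷ w)) (F (m ∷ w))) n
      ≈⟨ wordSeries-cong (λ w → indicator-⇔ (run? m (m ∷ w)) (run? m w) (λ { (_ ∷ p) → p }) (≡.refl ∷_)) n ⟩
    gf (run? m) (F ∘ (m ∷_)) n
      ≈⟨ gf-run m≤r (F ∘ (m ∷_)) n ⟩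
    F (m ∷ replicate n m) ∎

module Powers {c ℓ} (R : CommutativeRing c ℓ) where
  open import Algebra.Bundles using (CommutativeRing)
  open import Defs
  open import Data.Nat using (zero; suc)
  import Data.Nat as ℕ
  open import Relation.Binary.PropositionalEquality as ≡ using (_≡_)

  open CommutativeRing R
  open Series R using (_^R_)
  open import Algebra.Properties.Semiring.Exp semiring using (_^_; ^-homo-*; ^-assocʳ)
  open import Algebra.Properties.CommutativeSemiring.Exp commutativeSemiring using (^-distrib-*)

  private
    ^R≡^ : ∀ a n → a ^R n ≡ a ^ n
    ^R≡^ a zero    = ≡.refl
    ^R≡^ a (suc n) = ≡.cong (a *_) (^R≡^ a n)

  ^R-+ : ∀ a i j → a ^R (i ℕ.+ j) ≈ a ^R i * a ^R j
  ^R-+ a i j rewrite ^R≡^ a (i ℕ.+ j) | ^R≡^ a i | ^R≡^ a j = ^-homo-* a i j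

  ^R-*ˡ : ∀ a i j → (a ^R i) ^R j ≈ a ^R (i ℕ.* j)
  ^R-*ˡ a i j rewrite ^R≡^ (a ^R i) j | ^R≡^ a i | ^R≡^ a (i ℕ.* j) = ^-assocʳ a i j

  ^R-distrib : ∀ a b n → (a * b) ^R n ≈ a ^R n * b ^R n
  ^R-distrib a b n rewrite ^R≡^ (a * b) n | ^R≡^ a n | ^R≡^ b n = ^-distrib-* a b n

  ^R-one : ∀ n → 1# ^R n ≈ 1#
  ^R-one zero    = refl
  ^R-one (suc n) = trans (*-identityˡ _) (^R-one n)

module Weights {c ℓ} (R : CommutativeRing c ℓ) (s q : CommutativeRing.Carrier R) where
  open import Defs
  open import Algebra.Bundles using (CommutativeRing)
  open import Data.Nat using (z≤n)
  import Data.Nat as ℕ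
  open import Data.Nat.ListAction.Properties using (sum-++)
  open import Data.List using ([]; _∷_; _++_; length; replicate)
  open import Data.List.Properties using (length-replicate)
  open import Relation.Binary.PropositionalEquality as ≡ using (_≡_)
  open WordStatistics
  open Factorisations

  open CommutativeRing R
  open Series R using (_^R_)
  open import Relation.Binary.Reasoning.Setoid setoid
  open Powers R
  open import Algebra.Properties.CommutativeSemigroup *-commutativeSemigroup using (interchange)

  weight₀ : Word → Carrier
  weight₀ w = s ^R dec w * q ^R tot w

  -- The summand of the theorem, with single w replaced by nondecRecords 0 w.
  weight : Carrier → Word → Carrier
  weight Y w = weight₀ w * Y ^R nondecRecords 0 w

  runWeight : Word → Carrier
  runWeight w = s ^R length w * q ^R tot w

  private
    ^R-split : ∀ a i j {k} → i ℕ.+ j ≡ k → a ^R i * a ^R j ≈ a ^R k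
    ^R-split a i j ≡.refl = sym (^R-+ a i j)

  weight₀-[] : weight₀ [] ≈ 1#
  weight₀-[] = *-identityˡ 1#

  weight-[] : ∀ Y → weight Y [] ≈ 1#
  weight-[] Y = trans (*-identityʳ _) weight₀-[]

  weight₀-++ : ∀ a b → Joinable a b → weight₀ a * weight₀ b ≈ weight₀ (a ++ b)
  weight₀-++ a b ab = trans (interchange _ _ _ _)
    (*-cong (^R-split s (dec a) (dec b) (≡.sym (dec-joinable a b ab)))
            (^R-split q (tot a) (tot b) (≡.sym (sum-++ a b))))

  weight-++ : ∀ Y a b → Joinable a b → weight Y a * weight Y b ≈ weight Y (a ++ b)
  weight-++ Y a b ab = trans (interchange _ _ _ _)
    (*-cong (weight₀-++ a b ab)
            (^R-split Y (nondecRecords 0 a) (nondecRecords 0 b) (≡.sym (nondecRecords-joinable a b ab))))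

  runWeight-++ : ∀ {m a b} → Run m a → Valley m b → runWeight a * weight₀ b ≈ weight₀ (a ++ b)
  runWeight-++ {a = a} {b = y ∷ b} ra (valley y<m _) = trans (interchange _ _ _ _)
    (*-cong (^R-split s (length a) (dec (y ∷ b)) (≡.sym (dec-run-++ b ra y<m)))
            (^R-split q (tot a) (tot (y ∷ b)) (≡.sym (sum-++ a (y ∷ b)))))

  weight-peak : ∀ Y {m w} → Peak m w → weight Y w ≈ weight₀ w
  weight-peak Y empty    = *-identityʳ _
  weight-peak Y (peak e) rewrite nondecRecords-peak e = *-identityʳ _

  weight-one : ∀ w → weight 1# w ≈ weight₀ w
  weight-one w = trans (*-congˡ (^R-one (nondecRecords 0 w))) (*-identityʳ _)

  weight-replicate : ∀ Y m n → weight Y (replicate n m) ≈ (Y * q ^R m) ^R n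
  weight-replicate Y m n
    rewrite dec-replicate m n | tot-replicate m n | nondecRecords-replicate {0} {m} n z≤n = begin
    (1# * q ^R (m ℕ.* n)) * Y ^R n ≈⟨ *-congʳ (*-identityˡ _) ⟩
    q ^R (m ℕ.* n) * Y ^R n        ≈⟨ *-comm _ _ ⟩
    Y ^R n * q ^R (m ℕ.* n)        ≈⟨ *-congˡ (^R-*ˡ q m n) ⟨
    Y ^R n * (q ^R m) ^R n         ≈⟨ ^R-distrib Y (q ^R m) n ⟨
    (Y * q ^R m) ^R n              ∎

  runWeight-replicate : ∀ m n → runWeight (replicate n m) ≈ (s * q ^R m) ^R n
  runWeight-replicate m n rewrite length-replicate n {m} | tot-replicate m n = begin
    s ^R n * q ^R (m ℕ.* n)        ≈⟨ *-congˡ (^R-*ˡ q m n) ⟨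
    s ^R n * (q ^R m) ^R n         ≈⟨ ^R-distrib s (q ^R m) n ⟨
    (s * q ^R m) ^R n              ∎

module RingIdentities {c ℓ} (R : CommutativeRing c ℓ) where
  open import Algebra.Bundles using (CommutativeRing)
  open RingSolver using (module Solver)

  open CommutativeRing R
  open Solver R
  open import Relation.Binary.Reasoning.Setoid setoid

  x≈1+yx⇒x[1-y]≈1 : ∀ {x y} → x ≈ 1# + y * x → x * (1# - y) ≈ 1#
  x≈1+yx⇒x[1-y]≈1 {x} {y} x≈1+yx = begin
    x * (1# - y)           ≈⟨ solve 2 (λ x y → x :* (one :- y) := x :- y :* x) refl x y ⟩
    x - y * x              ≈⟨ +-congʳ x≈1+yx ⟩
    (1# + y * x) - y * x   ≈⟨ solve 2 (λ x y → (one :+ y :* x) :- y :* x := one) refl x y ⟩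
    1#                     ∎

  L*[1-[g-1][a-1]]≈1-a[1-L] : ∀ {g L a} → g * L ≈ 1# →
                              L * (1# - (g - 1#) * (a - 1#)) ≈ 1# - a * (1# - L)
  L*[1-[g-1][a-1]]≈1-a[1-L] {g} {L} {a} gL≈1 = begin
    L * (1# - (g - 1#) * (a - 1#)) ≈⟨ solve 3 (λ g L a → L :* (one :- (g :- one) :* (a :- one))
                                                          := L :- (g :* L :- L) :* (a :- one)) refl g L a ⟩
    L - (g * L - L) * (a - 1#)     ≈⟨ +-congˡ (-‿cong (*-congʳ (+-congʳ gL≈1))) ⟩
    L - (1# - L) * (a - 1#)        ≈⟨ solve 2 (λ L a → L :- (one :- L) :* (a :- one) := one :- a :* (one :- L)) refl L a ⟩
    1# - a * (1# - L)              ∎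

  -- With Lc = 1 - σ (1 - ℓ) and E = 1 - (g - 1) (a - 1), the left side is
  -- ((1 - σ) pℓ S (1 - a (1 - Lc)) + ℓ (h₁ - h₂)) P, where h₁ ≈ h₂ is the
  -- hypothesis; g Lc = 1 turns 1 - a (1 - Lc) into Lc E, and P E = 1.
  pochhammer-step : ∀ {a p S ℓ σ P g} →
    P * (1# - (g - 1#) * (a - 1#)) ≈ 1# →
    g * (1# - σ * (1# - ℓ)) ≈ 1# →
    a * (p * ℓ) * (p - σ * S) ≈ (1# - σ) * (p * S) →
    a * (p * ℓ) * P * (p * ℓ - σ * (S * (1# - σ * (1# - ℓ))))
      ≈ (1# - σ) * (p * ℓ * (S * (1# - σ * (1# - ℓ))))
  pochhammer-step {a} {p} {S} {ℓ} {σ} {P} {g} PE≈1 gLc≈1 hyp = begin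
    A * P * (p * ℓ - σ * (S * Lc))
      ≈⟨ swap A P _ ⟩
    A * (p * ℓ - σ * (S * Lc)) * P
      ≈⟨ *-congʳ expand ⟩
    (κ * (p * ℓ) * S * (1# - a * (1# - Lc)) + ℓ * (A * (p - σ * S) - κ * (p * S))) * P
      ≈⟨ *-congʳ (+-congˡ (*-congˡ (trans (+-congʳ hyp) (-‿inverseʳ _)))) ⟩
    (κ * (p * ℓ) * S * (1# - a * (1# - Lc)) + ℓ * 0#) * P
      ≈⟨ *-congʳ (trans (+-congˡ (zeroʳ ℓ)) (+-identityʳ _)) ⟩
    κ * (p * ℓ) * S * (1# - a * (1# - Lc)) * P
      ≈⟨ *-congʳ (*-congˡ (L*[1-[g-1][a-1]]≈1-a[1-L] gLc≈1)) ⟨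
    κ * (p * ℓ) * S * (Lc * E) * P
      ≈⟨ regroup κ (p * ℓ) S Lc E P ⟩
    κ * (p * ℓ * (S * Lc)) * (P * E)
      ≈⟨ *-congˡ PE≈1 ⟩
    κ * (p * ℓ * (S * Lc)) * 1#
      ≈⟨ *-identityʳ _ ⟩
    κ * (p * ℓ * (S * Lc)) ∎
    where
    A  = a * (p * ℓ)
    κ  = 1# - σ
    Lc = 1# - σ * (1# - ℓ)
    E  = 1# - (g - 1#) * (a - 1#)

    swap : ∀ x y z → x * y * z ≈ x * z * y
    swap = solve 3 (λ x y z → x :* y :* z := x :* z :* y) refl

    regroup : ∀ k x y l e f → k * x * y * (l * e) * f ≈ k * (x * (y * l)) * (f * e)
    regroup = solve 6 (λ k x y l e f → k :* x :* y :* (l :* e) :* f := k :* (x :* (y :* l)) :* (f :* e)) refl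

    expand : A * (p * ℓ - σ * (S * Lc))
             ≈ κ * (p * ℓ) * S * (1# - a * (1# - Lc)) + ℓ * (A * (p - σ * S) - κ * (p * S))
    expand = solve 5 (λ a p S ℓ σ →
      let Lc = one :- σ :* (one :- ℓ) in
      a :* (p :* ℓ) :* (p :* ℓ :- σ :* (S :* Lc))
        := (one :- σ) :* (p :* ℓ) :* S :* (one :- a :* (one :- Lc))
           :+ ℓ :* (a :* (p :* ℓ) :* (p :- σ :* S) :- (one :- σ) :* (p :* S))) refl a p S ℓ σ

module GeneratingFunctions {c ℓ} (R : CommutativeRing c ℓ) (r : ℕ) (s q : CommutativeRing.Carrier R) where
  open import Defs
  open import Algebra.Bundles using (CommutativeRing)
  open import Data.Nat using (ℕ; zero; suc; _≤_; _<_; s≤s; z≤n)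
  open import Data.Nat.Properties using (≤-refl; <⇒≤; m≤n⇒m≤1+n)
  open import Data.List using ([]; _++_)
  open import Data.List.Relation.Unary.All using ([])
  open WordStatistics
  open LyndonSingles
  open Factorisations
  open RingSolver using (module Solver)

  private module R = CommutativeRing R
  open R using (Carrier; _*_; 1#)
  open Series R using (PS; _^R_; oneS; lin; poch; _·_; wordSum; denom; numer)
  open PowerSeriesRing R
  open WordSeries R r
  open Weights R s q
  private module 𝒫 = CommutativeRing powerSeriesRing
  open RingIdentities powerSeriesRing
  open Solver powerSeriesRing
  open import Relation.Binary.Reasoning.Setoid 𝒫.setoid

  lowSeries : Carrier → ℕ → PS
  lowSeries Y m = gf (low? m) (weight Y)

  peakSeries : ℕ → PS
  peakSeries m = gf (peak? m) weight₀

  peakProduct : ℕ → PS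
  peakProduct zero    = oneS
  peakProduct (suc m) = peakProduct m ⊗ peakSeries m

  poch-suc : ∀ a m → poch a q (suc m) ≋ poch a q m ⊗ lin (a * q ^R m)
  poch-suc a m = ⊛≈⊗ (poch a q m) (lin (a * q ^R m))

  lin-* : ∀ a b → lin (a * b) ≋ oneS ⊖ C a ⊗ (oneS ⊖ lin b)
  lin-* a b = begin
    lin (a * b)
      ≈⟨ lin≋ (a * b) ⟩
    oneS ⊖ C (a * b) ⊗ X
      ≈⟨ 𝒫.+-congˡ (𝒫.-‿cong (𝒫.trans (𝒫.*-congʳ (C-* a b)) (𝒫.*-assoc _ _ _))) ⟩
    oneS ⊖ C a ⊗ (C b ⊗ X)
      ≈⟨ 𝒫.+-congˡ (𝒫.-‿cong (𝒫.*-congˡ 1-[1-y]≈y)) ⟨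
    oneS ⊖ C a ⊗ (oneS ⊖ (oneS ⊖ C b ⊗ X))
      ≈⟨ 𝒫.+-congˡ (𝒫.-‿cong (𝒫.*-congˡ (𝒫.+-congˡ (𝒫.-‿cong (lin≋ b))))) ⟨
    oneS ⊖ C a ⊗ (oneS ⊖ lin b) ∎
    where
    1-[1-y]≈y : oneS ⊖ (oneS ⊖ C b ⊗ X) ≋ C b ⊗ X
    1-[1-y]≈y = solve 1 (λ y → one :- (one :- y) := y) 𝒫.refl _

  topSeries : ∀ Y {m} → m ≤ r → gf (top? m) (weight Y) ≋ peakSeries m ⊗ geom (Y * q ^R m)
  topSeries Y {m} m≤r = begin
    gf (top? m) (weight Y)                           ≈⟨ gf-product (peak? m) (run? m) (top? m) (peak-run m) joined ⟨
    gf (peak? m) (weight Y) ⊗ gf (run? m) (weight Y) ≈⟨ 𝒫.*-cong (gf-cong (peak? m) (weight-peak Y)) runs ⟩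
    peakSeries m ⊗ geom (Y * q ^R m)                 ∎
    where
    joined : ∀ {a b} → Peak m a → Run m b → weight Y a * weight Y b R.≈ weight Y (a ++ b)
    joined pa rb = weight-++ Y _ _ (peak-run-joinable pa rb)

    runs : gf (run? m) (weight Y) ≋ geom (Y * q ^R m)
    runs n = R.trans (gf-run m≤r (weight Y) n) (weight-replicate Y m n)

  lowSeries-suc : ∀ Y {m} → m ≤ r → lowSeries Y (suc m) ≋ lowSeries Y m ⊗ (peakSeries m ⊗ geom (Y * q ^R m))
  lowSeries-suc Y {m} m≤r = begin
    lowSeries Y (suc m)                             ≈⟨ gf-product (low? m) (top? m) (low? (suc m)) (low-top m) joined ⟨
    lowSeries Y m ⊗ gf (top? m) (weight Y)          ≈⟨ 𝒫.*-congˡ (topSeries Y m≤r) ⟩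
    lowSeries Y m ⊗ (peakSeries m ⊗ geom (Y * q ^R m)) ∎
    where
    joined : ∀ {a b} → Low m a → Top m b → weight Y a * weight Y b R.≈ weight Y (a ++ b)
    joined la tb = weight-++ Y _ _ (low-top-joinable la tb)

  lowSeries⊗poch : ∀ Y L → L ≤ suc r → lowSeries Y L ⊗ poch Y q L ≋ peakProduct L
  lowSeries⊗poch Y zero    _         = 𝒫.trans (𝒫.*-congʳ (gf-low-zero (weight-[] Y))) (𝒫.*-identityˡ oneS)
  lowSeries⊗poch Y (suc L) (s≤s L≤r) = begin
    lowSeries Y (suc L) ⊗ poch Y q (suc L)
      ≈⟨ 𝒫.*-cong (lowSeries-suc Y L≤r) (poch-suc Y L) ⟩
    lowSeries Y L ⊗ (peakSeries L ⊗ geom y) ⊗ (poch Y q L ⊗ lin y)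
      ≈⟨ solve 5 (λ a b c d e → a :* (b :* c) :* (d :* e) := a :* d :* b :* (c :* e)) 𝒫.refl _ _ _ _ _ ⟩
    lowSeries Y L ⊗ poch Y q L ⊗ peakSeries L ⊗ (geom y ⊗ lin y)
      ≈⟨ 𝒫.*-cong (𝒫.*-congʳ (lowSeries⊗poch Y L (m≤n⇒m≤1+n L≤r))) (geom⊗lin y) ⟩
    peakProduct L ⊗ peakSeries L ⊗ oneS
      ≈⟨ 𝒫.*-identityʳ _ ⟩
    peakProduct (suc L) ∎
    where y = Y * q ^R L

  -- A peak is empty, or a run m⋯m followed by a valley, which is a word of
  -- letters < m followed by a peak.
  peakSeries-equation : ∀ {m} → m ≤ r →
    peakSeries m ⊗ (oneS ⊖ (geom (s * q ^R m) ⊖ oneS) ⊗ (lowSeries 1# m ⊖ oneS)) ≋ oneS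
  peakSeries-equation {m} m≤r = x≈1+yx⇒x[1-y]≈1 (begin
    peakSeries m                                                   ≈⟨ gf-⁺ (peak? m) empty weight₀-[] ⟩
    oneS ⊕ gf (peak? m ⁺?) weight₀                                 ≈⟨ 𝒫.+-congˡ peaks ⟩
    oneS ⊕ gf (run? m ⁺?) runWeight ⊗ gf (valley? m) weight₀       ≈⟨ 𝒫.+-congˡ (𝒫.*-cong runs valleys) ⟩
    oneS ⊕ (g ⊖ oneS) ⊗ (gf (low? m ⁺?) weight₀ ⊗ peakSeries m)    ≈⟨ 𝒫.+-congˡ (𝒫.*-congˡ (𝒫.*-congʳ lows)) ⟩
    oneS ⊕ (g ⊖ oneS) ⊗ ((lowSeries 1# m ⊖ oneS) ⊗ peakSeries m)   ≈⟨ 𝒫.+-congˡ (𝒫.*-assoc _ _ _) ⟨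
    oneS ⊕ (g ⊖ oneS) ⊗ (lowSeries 1# m ⊖ oneS) ⊗ peakSeries m     ∎)
    where
    g = geom (s * q ^R m)

    x≈1+y⇒y≈x-1 : ∀ {x y} → x ≋ oneS ⊕ y → y ≋ x ⊖ oneS
    x≈1+y⇒y≈x-1 {x} {y} x≈1+y =
      𝒫.trans (solve 1 (λ y → y := one :+ y :- one) 𝒫.refl y) (𝒫.+-congʳ (𝒫.sym x≈1+y))

    peaks : gf (peak? m ⁺?) weight₀ ≋ gf (run? m ⁺?) runWeight ⊗ gf (valley? m) weight₀
    peaks = 𝒫.sym (gf-product (run? m ⁺?) (valley? m) (peak? m ⁺?) (run-valley m)
                              (λ {a} ra vb → runWeight-++ (⁺⇒ {w = a} ra) vb))

    valleys : gf (valley? m) weight₀ ≋ gf (low? m ⁺?) weight₀ ⊗ peakSeries m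
    valleys = 𝒫.sym (gf-product (low? m ⁺?) (peak? m) (valley? m) (low-peak m)
                                (λ {a} la pb → weight₀-++ _ _ (low-peak-joinable (⁺⇒ {w = a} la) pb)))

    runs : gf (run? m ⁺?) runWeight ≋ g ⊖ oneS
    runs = x≈1+y⇒y≈x-1 (𝒫.trans (λ n → R.sym (R.trans (gf-run m≤r runWeight n) (runWeight-replicate m n)))
                                 (gf-⁺ (run? m) [] (R.*-identityˡ 1#)))

    lows : gf (low? m ⁺?) weight₀ ≋ lowSeries 1# m ⊖ oneS
    lows = x≈1+y⇒y≈x-1 (𝒫.trans (gf-cong (low? m) (λ {w} _ → weight-one w)) (gf-⁺ (low? m) [] weight₀-[]))

  peakSeries-zero : peakSeries 0 ≋ oneS
  peakSeries-zero = begin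
    P
      ≈⟨ solve 2 (λ P g → P := P :* (one :- (g :- one) :* (one :- one))) 𝒫.refl P g ⟩
    P ⊗ (oneS ⊖ (g ⊖ oneS) ⊗ (oneS ⊖ oneS))
      ≈⟨ 𝒫.*-congˡ (𝒫.+-congˡ (𝒫.-‿cong (𝒫.*-congˡ (𝒫.+-congʳ A₀≈1)))) ⟨
    P ⊗ (oneS ⊖ (g ⊖ oneS) ⊗ (lowSeries 1# 0 ⊖ oneS))
      ≈⟨ peakSeries-equation z≤n ⟩
    oneS ∎
    where
    P = peakSeries 0
    g = geom (s * q ^R 0)

    A₀≈1 : lowSeries 1# 0 ≋ oneS
    A₀≈1 = gf-low-zero (weight-[] 1#)

  σ : Carrier
  σ = s * q

  pochDiff : ℕ → PS
  pochDiff L = poch 1# q L ⊖ C σ ⊗ poch σ q L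

  pochProd : ℕ → PS
  pochProd L = (oneS ⊖ C σ) ⊗ (poch 1# q L ⊗ poch σ q L)

  peakProduct⊗pochDiff : ∀ L → L ≤ r → peakProduct (suc L) ⊗ pochDiff L ≋ pochProd L
  peakProduct⊗pochDiff zero    _ = begin
    oneS ⊗ peakSeries 0 ⊗ pochDiff 0 ≈⟨ 𝒫.*-congʳ (𝒫.*-congˡ peakSeries-zero) ⟩
    oneS ⊗ oneS ⊗ pochDiff 0         ≈⟨ solve 1 (λ c → one :* one :* (one :- c :* one) := (one :- c) :* (one :* one))
                                                𝒫.refl (C σ) ⟩
    pochProd 0                       ∎
  peakProduct⊗pochDiff (suc L) L<r = begin
    peakProduct (suc L) ⊗ P ⊗ pochDiff (suc L)
      ≈⟨ 𝒫.*-cong (𝒫.*-congʳ product) (𝒫.+-cong poch₁ (𝒫.-‿cong (𝒫.*-congˡ pochσ))) ⟩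
    a ⊗ (p ⊗ ℓ′) ⊗ P ⊗ (p ⊗ ℓ′ ⊖ C σ ⊗ (S ⊗ Lc))
      ≈⟨ pochhammer-step (peakSeries-equation L<r) geometric (𝒫.trans (𝒫.*-congʳ (𝒫.sym product)) IH) ⟩
    (oneS ⊖ C σ) ⊗ (p ⊗ ℓ′ ⊗ (S ⊗ Lc))
      ≈⟨ 𝒫.*-congˡ (𝒫.*-cong poch₁ pochσ) ⟨
    pochProd (suc L) ∎
    where
    a  = lowSeries 1# (suc L)
    p  = poch 1# q L
    ℓ′ = lin (q ^R L)
    S  = poch σ q L
    P  = peakSeries (suc L)
    Lc = oneS ⊖ C σ ⊗ (oneS ⊖ ℓ′)

    poch₁ : poch 1# q (suc L) ≋ p ⊗ ℓ′
    poch₁ = 𝒫.trans (poch-suc 1# L) (𝒫.*-congˡ (lin-cong (R.*-identityˡ _)))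

    pochσ : poch σ q (suc L) ≋ S ⊗ Lc
    pochσ = 𝒫.trans (poch-suc σ L) (𝒫.*-congˡ (lin-* σ (q ^R L)))

    product : peakProduct (suc L) ≋ a ⊗ (p ⊗ ℓ′)
    product = 𝒫.trans (𝒫.sym (lowSeries⊗poch 1# (suc L) (m≤n⇒m≤1+n L<r))) (𝒫.*-congˡ poch₁)

    geometric : geom (s * q ^R suc L) ⊗ Lc ≋ oneS
    geometric = 𝒫.trans (𝒫.*-congˡ (𝒫.sym (𝒫.trans (lin-cong (R.sym (R.*-assoc s q _))) (lin-* σ (q ^R L)))))
                        (geom⊗lin _)

    IH : peakProduct (suc L) ⊗ pochDiff L ≋ pochProd L
    IH = peakProduct⊗pochDiff L (<⇒≤ L<r)

  wordSum≋lowSeries : ∀ {fact} → (∀ w → IsLyndonFactorization w (fact w)) → ∀ Y →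
                      wordSum fact r s q Y ≋ lowSeries Y (suc r)
  wordSum≋lowSeries {fact} isFact Y n = R.trans (wordSeries-cong summand n) (R.sym (gf-all (weight Y) n))
    where
    summand : ∀ w → s ^R dec w * (q ^R tot w * Y ^R singles (fact w)) R.≈ weight Y w
    summand w rewrite singles≡nondecRecords (isFact w) = R.sym (R.*-assoc _ _ _)

  denom≋ : ∀ Y → denom r s q Y ≋ pochDiff r ⊗ poch Y q (suc r)
  denom≋ Y n =
    R.trans (⊛≈⊗ _ _ n) (⊗-cong (λ k → R.+-congˡ (R.-‿cong (·≋C⊗ σ (poch σ q r) k))) (λ _ → R.refl) n)

  numer≋ : numer r s q ≋ pochProd r
  numer≋ n = R.trans (·≋C⊗ _ _ n) (⊗-cong C[1-qs] (λ k → ⊛≈⊗ _ _ k) n)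
    where
    C[1-qs] : C (1# R.- q * s) ≋ oneS ⊖ C σ
    C[1-qs] = 𝒫.trans (C-‿ 1# (q * s)) (𝒫.+-cong C-1 (𝒫.-‿cong (C-cong (R.*-comm q s))))

corollary2p2 : {c ℓ : Level} (R : CommutativeRing c ℓ)
    (fact : List ℕ → List Word) → (∀ w → IsLyndonFactorization w (fact w)) →
    (r : ℕ) (s q Y : CommutativeRing.Carrier R) (n : ℕ) →
    CommutativeRing._≈_ R
      (Series._⊛_ R (Series.wordSum R fact r s q Y) (Series.denom R r s q Y) n)
      (Series.numer R r s q n)
corollary2p2 R fact isFact r s q Y n = CommutativeRing.trans R (⊛≈⊗ _ _ n) (product≋numer n)
  where
  open Series R using (wordSum; denom; numer; poch)
  open PowerSeriesRing R
  open GeneratingFunctions R r s q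
  module 𝒫 = CommutativeRing powerSeriesRing
  open RingSolver.Solver powerSeriesRing
  open import Relation.Binary.Reasoning.Setoid 𝒫.setoid

  product≋numer : wordSum fact r s q Y ⊗ denom r s q Y ≋ numer r s q
  product≋numer = begin
    wordSum fact r s q Y ⊗ denom r s q Y                  ≈⟨ 𝒫.*-cong (wordSum≋lowSeries isFact Y) (denom≋ Y) ⟩
    lowSeries Y (suc r) ⊗ (pochDiff r ⊗ poch Y q (suc r)) ≈⟨ solve 3 (λ a d p → a :* (d :* p) := a :* p :* d) 𝒫.refl _ _ _ ⟩
    lowSeries Y (suc r) ⊗ poch Y q (suc r) ⊗ pochDiff r   ≈⟨ 𝒫.*-congʳ (lowSeries⊗poch Y (suc r) ≤-refl) ⟩
    peakProduct (suc r) ⊗ pochDiff r                      ≈⟨ peakProduct⊗pochDiff r ≤-refl ⟩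
    pochProd r                                            ≈⟨ numer≋ ⟨
    numer r s q                                           ∎
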